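{- Let $0\le h\le n$. (1) If $h+1\le b\le n$ and $b+c=n$, then $D_{n,h}(0,b,c)=\dfrac{\prod_{l=h+1}^{b}(1-(-q)^l)}{1-(-q)^{b-h}}$. (2) If $h-1\le b\le n$ and $b+c=n-1$, then $D_{n,h}(1,b,c)=1$ if $b\in\{h-1,h\}$, and $D_{n,h}(1,b,c)=\prod_{l=h+1}^{b}(1-(-q)^l)$ if $b\ge h+1$.
   Context: $q$ is a power of an odd prime; $b,c\ge0$ are integers. Put $P(k)=\prod_{l=1}^{k}(1-(-q)^{ -l})$ (empty products $=1$, empty sums $=0$). For nonnegative integers $a,b,c$ and integer $j$: if $a+b>0$, $\mathcal C_j(a,b,c)=(-1)^{j+1}\prod_{i=1}^{a+b-1}(1-(-q)^i)$; and $\mathcal C_j(0,0,c)=\sum_{l=1}^{c}\frac1{(-q)^l-1}$. Let $M_{n,h}(a,b,c,i,s)=(-q)^{n(h-i)+\frac{(i-s)(2n-i+s+1)}{2}-h^2+s(2n-2c-s)}(-1)^{i+h}\frac{P(n-i)}{P(n-h)P(h)}\cdot\frac{\prod_{l=s+1}^{h}(1-(-q)^{ -l})}{P(h-i)P(i-s)}\cdot\frac{P(c)P(b)}{P(c-i+s)P(b-s)}\cdot\mathcal C_{h+1-s}(a,b-s,c+s-i)$. For nonnegative $a,b,c$ with $a+b+c=n$ and $(a,b,c)\ne(0,t,n-t)$ for $t\le h-1$, $D_{n,h}(a,b,c)=\sum_{0\le s\le\min(h,b)}\sum_{s\le i\le\min(s+c,h)}M_{n,h}(a,b,c,i,s)$.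 -}

module Defs where

open import Data.Nat as ℕ using (ℕ; zero; suc; _∸_; _⊓_; _≤_)
open import Data.Nat.Primality using (Prime)
import Data.Nat.DivMod as ℕD
open import Data.Integer as ℤ using (ℤ; +_; -[1+_])
open import Data.Rational as ℚ using (ℚ; 0ℚ; 1ℚ; _+_; _*_; -_; _-_; 1/_; _≟_)
open import Data.Product using (∃; ∃-syntax; _×_)
open import Relation.Binary.PropositionalEquality using (_≡_)
open import Relation.Nullary using (yes; no; ¬_)

IsOddPrimePower : ℕ → Set
IsOddPrimePower q = ∃[ p ] ∃[ k ] (Prime p × ¬ (p ≡ 2) × 1 ℕ.≤ k × q ≡ p ℕ.^ k)

-- total inverse on ℚ (only ever applied to nonzero arguments here)
inv : ℚ → ℚ
inv x with x ≟ 0ℚ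
... | yes _ = 0ℚ
... | no x≢0 = 1/_ x {{ℚ.≢-nonZero x≢0}}

infixl 7 _÷_
_÷_ : ℚ → ℚ → ℚ
x ÷ y = x * inv y

infixr 8 _^ℕ_
_^ℕ_ : ℚ → ℕ → ℚ
x ^ℕ zero = 1ℚ
x ^ℕ suc k = x * (x ^ℕ k)

infixr 8 _^ℤ_
_^ℤ_ : ℚ → ℤ → ℚ
x ^ℤ (+ k) = x ^ℕ k
x ^ℤ -[1+ k ] = inv (x ^ℕ suc k)

-- ∏_{l = lo}^{hi} f l   and   ∑_{l = lo}^{hi} f l   (empty if hi < lo)
prodFromTo : ℕ → ℕ → (ℕ → ℚ) → ℚ
prodFromTo lo hi f = go (suc hi ∸ lo)
  where
  go : ℕ → ℚ
  go zero = 1ℚ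
  go (suc m) = f (lo ℕ.+ m) * go m

sumFromTo : ℕ → ℕ → (ℕ → ℚ) → ℚ
sumFromTo lo hi f = go (suc hi ∸ lo)
  where
  go : ℕ → ℚ
  go zero = 0ℚ
  go (suc m) = f (lo ℕ.+ m) + go m

module _ (q : ℕ) where

  mq : ℚ
  mq = - ((+ q) ℚ./ 1)

  P : ℕ → ℚ
  P k = prodFromTo 1 k (λ l → 1ℚ - mq ^ℤ (ℤ.- (+ l)))

  sgn : ℕ → ℚ
  sgn m = (- 1ℚ) ^ℕ m

  𝒞 : ℕ → ℕ → ℕ → ℕ → ℚ
  𝒞 j zero zero c = sumFromTo 1 c (λ l → inv (mq ^ℕ l - 1ℚ))
  𝒞 j a b c = sgn (suc j) * prodFromTo 1 (a ℕ.+ b ∸ 1) (λ i → 1ℚ - mq ^ℕ i)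

  expM : ℕ → ℕ → ℕ → ℕ → ℕ → ℤ
  expM n h c i s =
    ℤ.+ (n ℕ.* (h ∸ i))
    ℤ.+ ℤ.+ (((i ∸ s) ℕ.* (2 ℕ.* n ∸ i ℕ.+ s ℕ.+ 1)) ℕD./ 2)
    ℤ.- ℤ.+ (h ℕ.* h)
    ℤ.+ ℤ.+ s ℤ.* (ℤ.+ (2 ℕ.* n) ℤ.- ℤ.+ (2 ℕ.* c) ℤ.- ℤ.+ s)

  M : ℕ → ℕ → ℕ → ℕ → ℕ → ℕ → ℕ → ℚ
  M n h a b c i s =
    mq ^ℤ expM n h c i s
    * sgn (i ℕ.+ h)
    * (P (n ∸ i) ÷ (P (n ∸ h) * P h))
    * (prodFromTo (suc s) h (λ l → 1ℚ - mq ^ℤ (ℤ.- (+ l))) ÷ (P (h ∸ i) * P (i ∸ s)))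
    * ((P c * P b) ÷ (P (c ℕ.+ s ∸ i) * P (b ∸ s)))
    * 𝒞 (suc h ∸ s) a (b ∸ s) (c ℕ.+ s ∸ i)

  D : ℕ → ℕ → ℕ → ℕ → ℕ → ℚ
  D n h a b c =
    sumFromTo 0 (h ⊓ b) (λ s → sumFromTo s ((s ℕ.+ c) ⊓ h) (λ i → M n h a b c i s))

{-# OPTIONS --safe #-}
module Submission where

-- Put x = -q and write the inner index as i = s + t.  Since P(k) = (-1)^k x^(-k(k+1)/2) (x;x)_k, the
-- factor P(h) cancels from M and every remaining quotient of P's is a Gaussian binomial in x times a
-- power of x; with h = s+t+r, c = t+u, n = h+e+c, b = s+v and v+a = t+r+e the summand becomes
--   M(s+t, s) = x^(s(e+a)) [b,s] C · [c,t] (-1)^t x^(te + t(t+1)/2) [r+e+c, r],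
-- where C comes from the C_j factor.  The sum over t is an alternating q-Vandermonde sum equal to
-- [h-s+e, h-s], and the remaining sum over s collapses by  Σ_s [h,s] x^(s(m+1)) (x;x)_(m+h-s) = (x;x)_m.

open import Defs
open import Data.Nat as ℕ using (ℕ; zero; suc; _∸_; _⊓_; _≤_; _<_; z≤n; s≤s)
import Data.Nat.Properties as ℕ
import Data.Nat.DivMod as ℕ using (m*n/n≡m)
import Data.Nat.Coprimality as Coprime
open import Data.Nat.Primality using (prime⇒nonTrivial)
open import Data.Integer as ℤ using (ℤ; -[1+_]; _⊖_)
import Data.Integer.Properties as ℤ
open import Data.Rational as ℚ using (ℚ; 0ℚ; 1ℚ; _*_; -_; _-_; _≟_)
open import Data.Rational.Properties as ℚ
  using (*-assoc; *-comm; *-identityˡ; *-identityʳ; *-zeroˡ; *-zeroʳ; +-identityˡ; +-identityʳ; +-*-commutativeRing)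
open import Data.Maybe using (Maybe)
open import Level using (0ℓ)
open import Data.Product using (_×_; _,_)
open import Data.Sum using (_⊎_; inj₁; inj₂)
open import Relation.Binary.PropositionalEquality
open import Relation.Nullary using (Dec; yes; no; contradiction)
open import Relation.Nullary.Decidable using (dec⇒maybe)
open import Algebra.Bundles using (CommutativeMonoid)
open import Algebra.Properties.CommutativeSemigroup (CommutativeMonoid.commutativeSemigroup ℚ.*-1-commutativeMonoid)
  using (interchange)
open import Tactic.RingSolver using (solve-∀)
import Tactic.RingSolver.Core.AlmostCommutativeRing as ACR
open import Data.Nat.Tactic.RingSolver using () renaming (solve-∀ to ℕ-solve-∀)
open import Data.Integer.Tactic.RingSolver using () renaming (solve-∀ to ℤ-solve-∀)

-- Kept in its own module: its rational _+_ would clash with the natural-number _+_ of the statement.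
module RationalAlgebra where

  open import Data.Rational using (_+_)
  open import Algebra.Properties.CommutativeSemigroup (CommutativeMonoid.commutativeSemigroup ℚ.+-0-commutativeMonoid)
    using () renaming (interchange to +-interchange)

  ℚ-ring : ACR.AlmostCommutativeRing 0ℓ 0ℓ
  ℚ-ring = ACR.fromCommutativeRing +-*-commutativeRing is-zero
    where
    is-zero : ∀ r → Maybe (0ℚ ≡ r)
    is-zero r = dec⇒maybe (0ℚ ≟ r)

  inv-inverseˡ : ∀ {a} → a ≢ 0ℚ → inv a * a ≡ 1ℚ
  inv-inverseˡ {a} a≢0 with a ≟ 0ℚ
  ... | yes a≡0 = contradiction a≡0 a≢0
  ... | no a≢0′ = ℚ.*-inverseˡ a {{ℚ.≢-nonZero a≢0′}}

  inv-inverseʳ : ∀ {a} → a ≢ 0ℚ → a * inv a ≡ 1ℚ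
  inv-inverseʳ {a} a≢0 = trans (*-comm a (inv a)) (inv-inverseˡ a≢0)

  *≡1⇒≢0 : ∀ {a b} → a * b ≡ 1ℚ → a ≢ 0ℚ
  *≡1⇒≢0 {b = b} ab≡1 refl = ℚ.1≢0 (trans (sym ab≡1) (*-zeroˡ b))

  inv-unique : ∀ {a b} → a * b ≡ 1ℚ → inv a ≡ b
  inv-unique {a} {b} ab≡1 = begin
    inv a            ≡⟨ sym (*-identityʳ (inv a)) ⟩
    inv a * 1ℚ       ≡⟨ cong (inv a *_) (sym ab≡1) ⟩
    inv a * (a * b)  ≡⟨ sym (*-assoc (inv a) a b) ⟩
    inv a * a * b    ≡⟨ cong (_* b) (inv-inverseˡ (*≡1⇒≢0 {a} {b} ab≡1)) ⟩
    1ℚ * b           ≡⟨ *-identityˡ b ⟩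
    b                ∎
    where open ≡-Reasoning

  *-inv-* : ∀ {a b} → a ≢ 0ℚ → b ≢ 0ℚ → (a * b) * (inv a * inv b) ≡ 1ℚ
  *-inv-* {a} {b} a≢0 b≢0 = begin
    (a * b) * (inv a * inv b)  ≡⟨ interchange a b (inv a) (inv b) ⟩
    (a * inv a) * (b * inv b)  ≡⟨ cong₂ _*_ (inv-inverseʳ a≢0) (inv-inverseʳ b≢0) ⟩
    1ℚ                         ∎
    where open ≡-Reasoning

  *-≢0 : ∀ {a b} → a ≢ 0ℚ → b ≢ 0ℚ → a * b ≢ 0ℚ
  *-≢0 {a} {b} a≢0 b≢0 = *≡1⇒≢0 {a * b} (*-inv-* a≢0 b≢0)

  inv-distrib-* : ∀ a b → inv (a * b) ≡ inv a * inv b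
  inv-distrib-* a b = by-cases (a ≟ 0ℚ) (b ≟ 0ℚ)
    where
    by-cases : Dec (a ≡ 0ℚ) → Dec (b ≡ 0ℚ) → inv (a * b) ≡ inv a * inv b
    by-cases (yes refl) _          = trans (cong inv (*-zeroˡ b)) (sym (*-zeroˡ (inv b)))
    by-cases (no _)     (yes refl) = trans (cong inv (*-zeroʳ a)) (sym (*-zeroʳ (inv a)))
    by-cases (no a≢0)   (no b≢0)   = inv-unique {a * b} (*-inv-* a≢0 b≢0)

  *-cancelʳ-≢0 : ∀ {a b c} → c ≢ 0ℚ → a * c ≡ b * c → a ≡ b
  *-cancelʳ-≢0 {a} {b} {c} c≢0 ac≡bc = begin
    a                ≡⟨ sym (cancel a) ⟩
    a * c * inv c    ≡⟨ cong (_* inv c) ac≡bc ⟩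
    b * c * inv c    ≡⟨ cancel b ⟩
    b                ∎
    where
    open ≡-Reasoning
    cancel : ∀ z → z * c * inv c ≡ z
    cancel z = trans (*-assoc z c (inv c)) (trans (cong (z *_) (inv-inverseʳ c≢0)) (*-identityʳ z))

  *≡⇒≡÷ : ∀ {a b c} → c ≢ 0ℚ → a * c ≡ b → a ≡ b ÷ c
  *≡⇒≡÷ {a} {b} {c} c≢0 ac≡b = *-cancelʳ-≢0 c≢0 (begin
    a * c                ≡⟨ ac≡b ⟩
    b                    ≡⟨ sym (*-identityʳ b) ⟩
    b * 1ℚ               ≡⟨ cong (b *_) (sym (inv-inverseˡ c≢0)) ⟩
    b * (inv c * c)      ≡⟨ sym (*-assoc b (inv c) c) ⟩
    b ÷ c * c            ∎)
    where open ≡-Reasoning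

  1-a≡-a[1-b] : ∀ {a b} → a * b ≡ 1ℚ → 1ℚ - a ≡ - 1ℚ * a * (1ℚ - b)
  1-a≡-a[1-b] {a} {b} ab≡1 = begin
    1ℚ - a                ≡⟨ lemma₁ a ⟩
    - 1ℚ * a + 1ℚ          ≡⟨ cong (- 1ℚ * a +_) (sym ab≡1) ⟩
    - 1ℚ * a + a * b       ≡⟨ lemma₂ a b ⟩
    - 1ℚ * a * (1ℚ - b)    ∎
    where
    open ≡-Reasoning
    lemma₁ : ∀ a → 1ℚ - a ≡ - 1ℚ * a + 1ℚ
    lemma₁ = solve-∀ ℚ-ring
    lemma₂ : ∀ a b → - 1ℚ * a + a * b ≡ - 1ℚ * a * (1ℚ - b)
    lemma₂ = solve-∀ ℚ-ring

  ^ℕ-+ : ∀ r m n → r ^ℕ (m ℕ.+ n) ≡ r ^ℕ m * r ^ℕ n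
  ^ℕ-+ r zero    n = sym (*-identityˡ _)
  ^ℕ-+ r (suc m) n = trans (cong (r *_) (^ℕ-+ r m n)) (sym (*-assoc r _ _))

  ^ℕ-regroup : ∀ r a b c d → a ℕ.+ b ≡ c ℕ.+ d → r ^ℕ a * r ^ℕ b ≡ r ^ℕ c * r ^ℕ d
  ^ℕ-regroup r a b c d eq = trans (sym (^ℕ-+ r a b)) (trans (cong (r ^ℕ_) eq) (^ℕ-+ r c d))

  ^ℕ-distrib-* : ∀ r s n → (r * s) ^ℕ n ≡ r ^ℕ n * s ^ℕ n
  ^ℕ-distrib-* r s zero    = refl
  ^ℕ-distrib-* r s (suc n) = trans (cong ((r * s) *_) (^ℕ-distrib-* r s n)) (interchange r s _ _)

  1^ℕ : ∀ n → 1ℚ ^ℕ n ≡ 1ℚ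
  1^ℕ zero    = refl
  1^ℕ (suc n) = trans (*-identityˡ _) (1^ℕ n)

  ^ℕ-inverse : ∀ {r s} n → r * s ≡ 1ℚ → r ^ℕ n * s ^ℕ n ≡ 1ℚ
  ^ℕ-inverse {r} {s} n rs≡1 = trans (sym (^ℕ-distrib-* r s n)) (trans (cong (_^ℕ n) rs≡1) (1^ℕ n))

  ^ℕ-+-cancel : ∀ {r s} m n → r * s ≡ 1ℚ → r ^ℕ (m ℕ.+ n) * s ^ℕ n ≡ r ^ℕ m
  ^ℕ-+-cancel {r} {s} m n rs≡1 = begin
    r ^ℕ (m ℕ.+ n) * s ^ℕ n      ≡⟨ cong (_* s ^ℕ n) (^ℕ-+ r m n) ⟩
    r ^ℕ m * r ^ℕ n * s ^ℕ n      ≡⟨ *-assoc (r ^ℕ m) (r ^ℕ n) (s ^ℕ n) ⟩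
    r ^ℕ m * (r ^ℕ n * s ^ℕ n)    ≡⟨ cong (r ^ℕ m *_) (^ℕ-inverse n rs≡1) ⟩
    r ^ℕ m * 1ℚ                   ≡⟨ *-identityʳ (r ^ℕ m) ⟩
    r ^ℕ m                        ∎
    where open ≡-Reasoning

  inv-^ℕ : ∀ r n → inv (r ^ℕ n) ≡ inv r ^ℕ n
  inv-^ℕ r zero    = inv-unique {1ℚ} (*-identityˡ 1ℚ)
  inv-^ℕ r (suc n) = trans (inv-distrib-* r (r ^ℕ n)) (cong (inv r *_) (inv-^ℕ r n))

  sign : ℕ → ℚ
  sign k = (- 1ℚ) ^ℕ k

  sign-+ : ∀ m n → sign (m ℕ.+ n) ≡ sign m * sign n
  sign-+ = ^ℕ-+ (- 1ℚ)

  sign-+-double : ∀ m k → sign (m ℕ.+ (k ℕ.+ k)) ≡ sign m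
  sign-+-double m k = begin
    sign (m ℕ.+ (k ℕ.+ k))        ≡⟨ sign-+ m (k ℕ.+ k) ⟩
    sign m * sign (k ℕ.+ k)        ≡⟨ cong (sign m *_) (trans (sign-+ k k) (^ℕ-inverse k refl)) ⟩
    sign m * 1ℚ                    ≡⟨ *-identityʳ (sign m) ⟩
    sign m                         ∎
    where open ≡-Reasoning

  sign-suc-suc : ∀ k → sign (suc (suc k)) ≡ sign k
  sign-suc-suc k = trans (cong sign (ℕ.+-comm 2 k)) (sign-+-double k 1)

  tri : ℕ → ℕ
  tri zero    = 0
  tri (suc k) = suc k ℕ.+ tri k

  tri-+ : ∀ m n → tri (m ℕ.+ n) ≡ tri m ℕ.+ tri n ℕ.+ m ℕ.* n
  tri-+ zero    n = sym (ℕ.+-identityʳ (tri n))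
  tri-+ (suc m) n = trans (cong (suc (m ℕ.+ n) ℕ.+_) (tri-+ m n)) (lemma m n (tri m) (tri n))
    where
    lemma : ∀ m n tm tn → suc (m ℕ.+ n) ℕ.+ (tm ℕ.+ tn ℕ.+ m ℕ.* n) ≡ suc m ℕ.+ tm ℕ.+ tn ℕ.+ suc m ℕ.* n
    lemma = ℕ-solve-∀

  tri-double : ∀ k → tri k ℕ.* 2 ≡ k ℕ.* suc k
  tri-double zero    = refl
  tri-double (suc k) = begin
    (suc k ℕ.+ tri k) ℕ.* 2        ≡⟨ ℕ.*-distribʳ-+ 2 (suc k) (tri k) ⟩
    suc k ℕ.* 2 ℕ.+ tri k ℕ.* 2    ≡⟨ cong (suc k ℕ.* 2 ℕ.+_) (tri-double k) ⟩
    suc k ℕ.* 2 ℕ.+ k ℕ.* suc k    ≡⟨ lemma k ⟩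
    suc k ℕ.* suc (suc k)          ∎
    where
    open ≡-Reasoning
    lemma : ∀ k → suc k ℕ.* 2 ℕ.+ k ℕ.* suc k ≡ suc k ℕ.* suc (suc k)
    lemma = ℕ-solve-∀

  ∑< : ℕ → (ℕ → ℚ) → ℚ
  ∑< zero    f = 0ℚ
  ∑< (suc m) f = f m + ∑< m f

  syntax ∑< m (λ j → e) = ∑[ j < m ] e

  ∑-cong : ∀ m {f g : ℕ → ℚ} → (∀ {j} → j < m → f j ≡ g j) → ∑< m f ≡ ∑< m g
  ∑-cong zero    f≗g = refl
  ∑-cong (suc m) f≗g = cong₂ _+_ (f≗g ℕ.≤-refl) (∑-cong m (λ j<m → f≗g (ℕ.m≤n⇒m≤1+n j<m)))

  ∑-+ : ∀ m (f g : ℕ → ℚ) → ∑[ j < m ] (f j + g j) ≡ ∑< m f + ∑< m g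
  ∑-+ zero    f g = refl
  ∑-+ (suc m) f g = trans (cong (f m + g m +_) (∑-+ m f g)) (+-interchange (f m) (g m) _ _)

  *-∑ : ∀ m k (f : ℕ → ℚ) → k * ∑< m f ≡ ∑[ j < m ] (k * f j)
  *-∑ zero    k f = *-zeroʳ k
  *-∑ (suc m) k f = trans (ℚ.*-distribˡ-+ k (f m) (∑< m f)) (cong (k * f m +_) (*-∑ m k f))

  ∑-vanishing-tail : ∀ {m} m′ (f : ℕ → ℚ) → m ≤ m′ → (∀ {j} → m ≤ j → j < m′ → f j ≡ 0ℚ) →
                     ∑< m′ f ≡ ∑< m f
  ∑-vanishing-tail {zero}  zero     f _ _ = refl
  ∑-vanishing-tail {suc m} zero     f () _
  ∑-vanishing-tail {m}     (suc m′) f m≤1+m′ tail≡0 with ℕ.m≤n⇒m<n∨m≡n m≤1+m′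
  ... | inj₂ refl       = refl
  ... | inj₁ (s≤s m≤m′) = begin
    f m′ + ∑< m′ f  ≡⟨ cong (_+ ∑< m′ f) (tail≡0 m≤m′ ℕ.≤-refl) ⟩
    0ℚ + ∑< m′ f    ≡⟨ +-identityˡ (∑< m′ f) ⟩
    ∑< m′ f         ≡⟨ ∑-vanishing-tail m′ f m≤m′ (λ m≤j j<m′ → tail≡0 m≤j (ℕ.m≤n⇒m≤1+n j<m′)) ⟩
    ∑< m f          ∎
    where open ≡-Reasoning

  sumFromTo-step : ∀ lo hi (f : ℕ → ℚ) → lo ≤ suc hi →
                   sumFromTo lo (suc hi) f ≡ f (suc hi) + sumFromTo lo hi f
  sumFromTo-step lo hi f lo≤1+hi rewrite ℕ.+-∸-assoc 1 lo≤1+hi | ℕ.m+[n∸m]≡n lo≤1+hi = refl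

  sumFromTo-+ : ∀ lo k (f : ℕ → ℚ) → sumFromTo lo (lo ℕ.+ k) f ≡ ∑[ j < suc k ] f (lo ℕ.+ j)
  sumFromTo-+ lo zero    f rewrite ℕ.+-∸-assoc 1 (ℕ.m≤m+n lo 0) | ℕ.m+n∸m≡n lo 0 = refl
  sumFromTo-+ lo (suc k) f rewrite ℕ.+-suc lo k =
    trans (sumFromTo-step lo (lo ℕ.+ k) f (ℕ.m≤n⇒m≤1+n (ℕ.m≤m+n lo k)))
          (cong (f (suc (lo ℕ.+ k)) +_) (sumFromTo-+ lo k f))

  prodFromTo-step : ∀ lo hi (f : ℕ → ℚ) → lo ≤ suc hi →
                    prodFromTo lo (suc hi) f ≡ f (suc hi) * prodFromTo lo hi f
  prodFromTo-step lo hi f lo≤1+hi rewrite ℕ.+-∸-assoc 1 lo≤1+hi | ℕ.m+[n∸m]≡n lo≤1+hi = refl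

  prodFromTo-empty : ∀ n (f : ℕ → ℚ) → prodFromTo (suc n) n f ≡ 1ℚ
  prodFromTo-empty n f rewrite ℕ.n∸n≡0 n = refl

  prodFromTo-split : ∀ (f : ℕ → ℚ) {h b} → h ≤ b → prodFromTo (suc h) b f * prodFromTo 1 h f ≡ prodFromTo 1 b f
  prodFromTo-split f {h} {zero}  z≤n = *-identityˡ 1ℚ
  prodFromTo-split f {h} {suc b} h≤1+b with ℕ.m≤n⇒m<n∨m≡n h≤1+b
  ... | inj₂ refl = trans (cong (_* prodFromTo 1 (suc b) f) (prodFromTo-empty (suc b) f)) (*-identityˡ _)
  ... | inj₁ (s≤s h≤b) = begin
    prodFromTo (suc h) (suc b) f * prodFromTo 1 h f       ≡⟨ cong (_* prodFromTo 1 h f) (prodFromTo-step (suc h) b f (s≤s h≤b)) ⟩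
    f (suc b) * prodFromTo (suc h) b f * prodFromTo 1 h f ≡⟨ *-assoc (f (suc b)) _ _ ⟩
    f (suc b) * (prodFromTo (suc h) b f * prodFromTo 1 h f) ≡⟨ cong (f (suc b) *_) (prodFromTo-split f h≤b) ⟩
    f (suc b) * prodFromTo 1 b f                           ∎
    where open ≡-Reasoning

  module QBinomial (x : ℚ) where

    poch : ℕ → ℚ
    poch k = prodFromTo 1 k (λ l → 1ℚ - x ^ℕ l)

    qBinom : ℕ → ℕ → ℚ
    qBinom n       zero    = 1ℚ
    qBinom zero    (suc k) = 0ℚ
    qBinom (suc n) (suc k) = qBinom n (suc k) + x ^ℕ (n ∸ k) * qBinom n k

    qBinom-> : ∀ {n k} → n < k → qBinom n k ≡ 0ℚ
    qBinom-> {zero}  {suc k} _ = refl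
    qBinom-> {suc n} {suc k} (s≤s n<k)
      rewrite qBinom-> {n} {suc k} (ℕ.m≤n⇒m≤1+n n<k) | qBinom-> n<k
      = trans (+-identityˡ _) (*-zeroʳ (x ^ℕ (n ∸ k)))

    qBinom-diag : ∀ n → qBinom n n ≡ 1ℚ
    qBinom-diag zero = refl
    qBinom-diag (suc n) rewrite qBinom-> {n} {suc n} ℕ.≤-refl | qBinom-diag n | ℕ.n∸n≡0 n = refl

    qBinom-poch : ∀ k m → qBinom (k ℕ.+ m) k * poch k * poch m ≡ poch (k ℕ.+ m)
    qBinom-poch zero    m       = trans (cong (_* poch m) (*-identityˡ 1ℚ)) (*-identityˡ (poch m))
    qBinom-poch (suc k) zero    rewrite ℕ.+-identityʳ k | qBinom-diag (suc k) = trans (*-identityʳ _) (*-identityˡ _)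
    qBinom-poch (suc k) (suc m) = begin
      (B₁ + x ^ℕ (k ℕ.+ suc m ∸ k) * B₀) * poch (suc k) * poch (suc m)
        ≡⟨ cong (λ e → (B₁ + x ^ℕ e * B₀) * poch (suc k) * poch (suc m)) (ℕ.m+n∸m≡n k (suc m)) ⟩
      (B₁ + E * B₀) * ((1ℚ - A) * poch k) * ((1ℚ - E) * poch m)
        ≡⟨ pascal-step B₁ B₀ (poch k) (poch m) A E ⟩
      (1ℚ - E) * (B₁ * ((1ℚ - A) * poch k) * poch m) + E * (1ℚ - A) * (B₀ * poch k * ((1ℚ - E) * poch m))
        ≡⟨ cong₂ (λ u v → (1ℚ - E) * u + E * (1ℚ - A) * v) IH₁ IH₀ ⟩
      (1ℚ - E) * poch n + E * (1ℚ - A) * poch n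
        ≡⟨ collect (poch n) A E ⟩
      (1ℚ - E * A) * poch n
        ≡⟨ cong (λ z → (1ℚ - z) * poch n) (trans (sym (^ℕ-+ x (suc m) (suc k))) (cong (x ^ℕ_) (ℕ.+-comm (suc m) (suc k)))) ⟩
      poch (suc k ℕ.+ suc m) ∎
      where
      open ≡-Reasoning
      n : ℕ
      n = k ℕ.+ suc m
      A E B₁ B₀ : ℚ
      A = x ^ℕ suc k
      E = x ^ℕ suc m
      B₁ = qBinom n (suc k)
      B₀ = qBinom n k
      IH₁ : B₁ * ((1ℚ - A) * poch k) * poch m ≡ poch n
      IH₁ = subst (λ n′ → qBinom n′ (suc k) * poch (suc k) * poch m ≡ poch n′) (sym (ℕ.+-suc k m)) (qBinom-poch (suc k) m)
      IH₀ : B₀ * poch k * ((1ℚ - E) * poch m) ≡ poch n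
      IH₀ = qBinom-poch k (suc m)
      pascal-step : ∀ b₁ b₀ p q a e → (b₁ + e * b₀) * ((1ℚ - a) * p) * ((1ℚ - e) * q)
                    ≡ (1ℚ - e) * (b₁ * ((1ℚ - a) * p) * q) + e * (1ℚ - a) * (b₀ * p * ((1ℚ - e) * q))
      pascal-step = solve-∀ ℚ-ring
      collect : ∀ p a e → (1ℚ - e) * p + e * (1ℚ - a) * p ≡ (1ℚ - e * a) * p
      collect = solve-∀ ℚ-ring

    ∑-pascal : ∀ c K (F : ℕ → ℚ) →
      ∑[ t < suc K ] (qBinom (suc c) t * F t)
      ≡ ∑[ t < suc K ] (qBinom c t * F t) + ∑[ t < K ] (x ^ℕ (c ∸ t) * qBinom c t * F (suc t))
    ∑-pascal c zero    F = sym (+-identityʳ _)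
    ∑-pascal c (suc K) F = trans (cong (qBinom (suc c) (suc K) * F (suc K) +_) (∑-pascal c K F))
      (regroup (qBinom c (suc K)) (qBinom c K) (x ^ℕ (c ∸ K)) (F (suc K)) _ _)
      where
      regroup : ∀ b₁ b₀ e f S₁ S₂ → (b₁ + e * b₀) * f + (S₁ + S₂) ≡ (b₁ * f + S₁) + (e * b₀ * f + S₂)
      regroup = solve-∀ ℚ-ring

    poch-expansion-step : ∀ m {h s} → s ≤ h →
      qBinom h s * (x ^ℕ (s ℕ.* suc m) * poch (m ℕ.+ (suc h ∸ s)))
        + x ^ℕ (h ∸ s) * qBinom h s * (x ^ℕ (suc s ℕ.* suc m) * poch (m ℕ.+ (h ∸ s)))
      ≡ qBinom h s * (x ^ℕ (s ℕ.* suc m) * poch (m ℕ.+ (h ∸ s)))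
    poch-expansion-step m {h} {s} s≤h = begin
      B * (X₀ * poch (m ℕ.+ (suc h ∸ s))) + x ^ℕ (h ∸ s) * B * (X₁ * p)
        ≡⟨ cong (λ z → B * (X₀ * poch z) + x ^ℕ (h ∸ s) * B * (X₁ * p)) m+[1+h∸s]≡1+m+[h∸s] ⟩
      B * (X₀ * ((1ℚ - E) * p)) + x ^ℕ (h ∸ s) * B * (X₁ * p)
        ≡⟨ expand B X₀ E p (x ^ℕ (h ∸ s)) X₁ ⟩
      B * (X₀ * p) - B * (X₀ * E) * p + B * (x ^ℕ (h ∸ s) * X₁) * p
        ≡⟨ cong (λ z → B * (X₀ * p) - B * (X₀ * E) * p + B * z * p) exponents ⟩
      B * (X₀ * p) - B * (X₀ * E) * p + B * (X₀ * E) * p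
        ≡⟨ cancel (B * (X₀ * p)) (B * (X₀ * E) * p) ⟩
      B * (X₀ * p) ∎
      where
      open ≡-Reasoning
      B p X₀ X₁ E : ℚ
      B = qBinom h s
      p = poch (m ℕ.+ (h ∸ s))
      X₀ = x ^ℕ (s ℕ.* suc m)
      X₁ = x ^ℕ (suc s ℕ.* suc m)
      E = x ^ℕ suc (m ℕ.+ (h ∸ s))
      m+[1+h∸s]≡1+m+[h∸s] : m ℕ.+ (suc h ∸ s) ≡ suc (m ℕ.+ (h ∸ s))
      m+[1+h∸s]≡1+m+[h∸s] = trans (cong (m ℕ.+_) (ℕ.+-∸-assoc 1 s≤h)) (ℕ.+-suc m (h ∸ s))
      exponents : x ^ℕ (h ∸ s) * X₁ ≡ X₀ * E
      exponents = ^ℕ-regroup x (h ∸ s) (suc s ℕ.* suc m) (s ℕ.* suc m) (suc (m ℕ.+ (h ∸ s))) (lemma (h ∸ s) s m)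
        where
        lemma : ∀ d s m → d ℕ.+ suc s ℕ.* suc m ≡ s ℕ.* suc m ℕ.+ suc (m ℕ.+ d)
        lemma = ℕ-solve-∀
      expand : ∀ b a e p c a′ → b * (a * ((1ℚ - e) * p)) + c * b * (a′ * p) ≡ b * (a * p) - b * (a * e) * p + b * (c * a′) * p
      expand = solve-∀ ℚ-ring
      cancel : ∀ u v → u - v + v ≡ u
      cancel = solve-∀ ℚ-ring

    poch-expansion : ∀ m h → ∑[ s < suc h ] (qBinom h s * (x ^ℕ (s ℕ.* suc m) * poch (m ℕ.+ (h ∸ s)))) ≡ poch m
    poch-expansion m zero rewrite ℕ.+-identityʳ m = simplify (poch m)
      where
      simplify : ∀ p → 1ℚ * (1ℚ * p) + 0ℚ ≡ p
      simplify = solve-∀ ℚ-ring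
    poch-expansion m (suc h) = begin
      ∑[ s < suc (suc h) ] (qBinom (suc h) s * F s)
        ≡⟨ ∑-pascal h (suc h) F ⟩
      (qBinom h (suc h) * F (suc h) + S₀) + S₁
        ≡⟨ cong (λ z → (z * F (suc h) + S₀) + S₁) (qBinom-> {h} ℕ.≤-refl) ⟩
      (0ℚ * F (suc h) + S₀) + S₁
        ≡⟨ cong (_+ S₁) (trans (cong (_+ S₀) (*-zeroˡ (F (suc h)))) (+-identityˡ S₀)) ⟩
      S₀ + S₁
        ≡⟨ sym (∑-+ (suc h) (λ s → qBinom h s * F s) (λ s → x ^ℕ (h ∸ s) * qBinom h s * F (suc s))) ⟩
      ∑[ s < suc h ] (qBinom h s * F s + x ^ℕ (h ∸ s) * qBinom h s * F (suc s))
        ≡⟨ ∑-cong (suc h) (λ {s} s<1+h → poch-expansion-step m (ℕ.≤-pred s<1+h)) ⟩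
      ∑[ s < suc h ] (qBinom h s * (x ^ℕ (s ℕ.* suc m) * poch (m ℕ.+ (h ∸ s))))
        ≡⟨ poch-expansion m h ⟩
      poch m ∎
      where
      open ≡-Reasoning
      F : ℕ → ℚ
      F s = x ^ℕ (s ℕ.* suc m) * poch (m ℕ.+ (suc h ∸ s))
      S₀ S₁ : ℚ
      S₀ = ∑[ s < suc h ] (qBinom h s * F s)
      S₁ = ∑[ s < suc h ] (x ^ℕ (h ∸ s) * qBinom h s * F (suc s))

    alternating-term : ℕ → ℕ → ℕ → ℕ → ℚ
    alternating-term k d c t = sign t * x ^ℕ (t ℕ.* d ℕ.+ tri t) * qBinom (k ∸ t ℕ.+ d ℕ.+ c) (k ∸ t)

    alternating-term-step : ∀ {k t} d c → t < k →
      qBinom c t * alternating-term k d (suc c) t + x ^ℕ (c ∸ t) * qBinom c t * alternating-term k d (suc c) (suc t)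
      ≡ qBinom c t * alternating-term k d c t
    alternating-term-step {k} {t} d c t<k with t ℕ.≤? c
    ... | no t≰c rewrite qBinom-> (ℕ.≰⇒> t≰c) = vanish (F (suc c) t) (x ^ℕ (c ∸ t)) (F (suc c) (suc t)) (F c t)
      where
      F : ℕ → ℕ → ℚ
      F = alternating-term k d
      vanish : ∀ a e b f → 0ℚ * a + e * 0ℚ * b ≡ 0ℚ * f
      vanish = solve-∀ ℚ-ring
    ... | yes t≤c = begin
      B * (σ * X₀ * qBinom (k ∸ t ℕ.+ d ℕ.+ suc c) (k ∸ t)) + x ^ℕ (c ∸ t) * B * (- 1ℚ * σ * X₁ * Q₀)
        ≡⟨ cong (λ i → B * (σ * X₀ * qBinom (i ℕ.+ d ℕ.+ suc c) i) + x ^ℕ (c ∸ t) * B * (- 1ℚ * σ * X₁ * Q₀)) k∸t≡1+j ⟩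
      B * (σ * X₀ * (Q₁ + x ^ℕ (N ∸ j) * Q₀)) + x ^ℕ (c ∸ t) * B * (- 1ℚ * σ * X₁ * Q₀)
        ≡⟨ expand B σ X₀ Q₁ (x ^ℕ (N ∸ j)) Q₀ (x ^ℕ (c ∸ t)) X₁ ⟩
      B * (σ * X₀ * Q₁) + B * σ * (X₀ * x ^ℕ (N ∸ j)) * Q₀ - B * σ * (x ^ℕ (c ∸ t) * X₁) * Q₀
        ≡⟨ cong (λ z → B * (σ * X₀ * Q₁) + B * σ * (X₀ * x ^ℕ (N ∸ j)) * Q₀ - B * σ * z * Q₀) exponents ⟩
      B * (σ * X₀ * Q₁) + B * σ * (X₀ * x ^ℕ (N ∸ j)) * Q₀ - B * σ * (X₀ * x ^ℕ (N ∸ j)) * Q₀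
        ≡⟨ cancel (B * (σ * X₀ * Q₁)) (B * σ * (X₀ * x ^ℕ (N ∸ j)) * Q₀) ⟩
      B * (σ * X₀ * Q₁)
        ≡⟨ cong (λ n → B * (σ * X₀ * qBinom n (suc j))) (ℕ.+-suc (j ℕ.+ d) c) ⟩
      B * (σ * X₀ * qBinom (suc j ℕ.+ d ℕ.+ c) (suc j))
        ≡⟨ cong (λ i → B * (σ * X₀ * qBinom (i ℕ.+ d ℕ.+ c) i)) (sym k∸t≡1+j) ⟩
      B * alternating-term k d c t ∎
      where
      open ≡-Reasoning
      j N : ℕ
      j = k ∸ suc t
      N = j ℕ.+ d ℕ.+ suc c
      B σ X₀ X₁ Q₁ Q₀ : ℚ
      B = qBinom c t
      σ = sign t
      X₀ = x ^ℕ (t ℕ.* d ℕ.+ tri t)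
      X₁ = x ^ℕ (suc t ℕ.* d ℕ.+ tri (suc t))
      Q₁ = qBinom N (suc j)
      Q₀ = qBinom N j
      k∸t≡1+j : k ∸ t ≡ suc j
      k∸t≡1+j = ℕ.+-∸-assoc 1 t<k
      N∸j≡d+1+c : N ∸ j ≡ d ℕ.+ suc c
      N∸j≡d+1+c = trans (cong (_∸ j) (ℕ.+-assoc j d (suc c))) (ℕ.m+n∸m≡n j (d ℕ.+ suc c))
      exponents : x ^ℕ (c ∸ t) * X₁ ≡ X₀ * x ^ℕ (N ∸ j)
      exponents = ^ℕ-regroup x (c ∸ t) (suc t ℕ.* d ℕ.+ tri (suc t)) (t ℕ.* d ℕ.+ tri t) (N ∸ j) (begin
        c ∸ t ℕ.+ (suc t ℕ.* d ℕ.+ tri (suc t))         ≡⟨ lemma (c ∸ t) t d (tri t) ⟩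
        t ℕ.* d ℕ.+ tri t ℕ.+ (d ℕ.+ suc (c ∸ t ℕ.+ t)) ≡⟨ cong (λ z → t ℕ.* d ℕ.+ tri t ℕ.+ (d ℕ.+ suc z)) (ℕ.m∸n+n≡m t≤c) ⟩
        t ℕ.* d ℕ.+ tri t ℕ.+ (d ℕ.+ suc c)             ≡⟨ cong (t ℕ.* d ℕ.+ tri t ℕ.+_) (sym N∸j≡d+1+c) ⟩
        t ℕ.* d ℕ.+ tri t ℕ.+ (N ∸ j)                   ∎)
        where
        lemma : ∀ e t d T → e ℕ.+ (suc t ℕ.* d ℕ.+ (suc t ℕ.+ T)) ≡ t ℕ.* d ℕ.+ T ℕ.+ (d ℕ.+ suc (e ℕ.+ t))
        lemma = ℕ-solve-∀
      expand : ∀ b σ a q₁ e q₀ c a′ → b * (σ * a * (q₁ + e * q₀)) + c * b * (- 1ℚ * σ * a′ * q₀)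
               ≡ b * (σ * a * q₁) + b * σ * (a * e) * q₀ - b * σ * (c * a′) * q₀
      expand = solve-∀ ℚ-ring
      cancel : ∀ u v → u + v - v ≡ u
      cancel = solve-∀ ℚ-ring

    alternating-qVandermonde : ∀ k d c → ∑[ t < suc k ] (qBinom c t * alternating-term k d c t) ≡ qBinom (k ℕ.+ d) k
    alternating-qVandermonde k d zero = begin
      ∑[ t < suc k ] (qBinom 0 t * F t)
        ≡⟨ ∑-vanishing-tail (suc k) (λ t → qBinom 0 t * F t) (s≤s z≤n) vanish ⟩
      1ℚ * (1ℚ * 1ℚ * qBinom (k ℕ.+ d ℕ.+ 0) k) + 0ℚ
        ≡⟨ cong (λ n → 1ℚ * (1ℚ * 1ℚ * qBinom n k) + 0ℚ) (ℕ.+-identityʳ (k ℕ.+ d)) ⟩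
      1ℚ * (1ℚ * 1ℚ * qBinom (k ℕ.+ d) k) + 0ℚ
        ≡⟨ simplify (qBinom (k ℕ.+ d) k) ⟩
      qBinom (k ℕ.+ d) k ∎
      where
      open ≡-Reasoning
      F : ℕ → ℚ
      F = alternating-term k d 0
      vanish : ∀ {t} → 1 ≤ t → t < suc k → qBinom 0 t * F t ≡ 0ℚ
      vanish {suc t} _ _ = *-zeroˡ (F (suc t))
      simplify : ∀ a → 1ℚ * (1ℚ * 1ℚ * a) + 0ℚ ≡ a
      simplify = solve-∀ ℚ-ring
    alternating-qVandermonde k d (suc c) = begin
      ∑[ t < suc k ] (qBinom (suc c) t * F (suc c) t)
        ≡⟨ ∑-pascal c k (F (suc c)) ⟩
      (qBinom c k * F (suc c) k + S₀) + S₁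
        ≡⟨ ℚ.+-assoc (qBinom c k * F (suc c) k) S₀ S₁ ⟩
      qBinom c k * F (suc c) k + (S₀ + S₁)
        ≡⟨ cong₂ _+_ (cong (qBinom c k *_) top-term)
                     (sym (∑-+ k (λ t → qBinom c t * F (suc c) t) (λ t → x ^ℕ (c ∸ t) * qBinom c t * F (suc c) (suc t)))) ⟩
      qBinom c k * F c k + ∑[ t < k ] (qBinom c t * F (suc c) t + x ^ℕ (c ∸ t) * qBinom c t * F (suc c) (suc t))
        ≡⟨ cong (qBinom c k * F c k +_) (∑-cong k (alternating-term-step d c)) ⟩
      ∑[ t < suc k ] (qBinom c t * F c t)
        ≡⟨ alternating-qVandermonde k d c ⟩
      qBinom (k ℕ.+ d) k ∎
      where
      open ≡-Reasoning
      F : ℕ → ℕ → ℚ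
      F = alternating-term k d
      S₀ S₁ : ℚ
      S₀ = ∑[ t < k ] (qBinom c t * F (suc c) t)
      S₁ = ∑[ t < k ] (x ^ℕ (c ∸ t) * qBinom c t * F (suc c) (suc t))
      top-term : F (suc c) k ≡ F c k
      top-term rewrite ℕ.n∸n≡0 k = refl

    qBinom-poch′ : ∀ {k n} → k ≤ n → qBinom n k * poch k * poch (n ∸ k) ≡ poch n
    qBinom-poch′ {k} {n} k≤n =
      subst (λ n′ → qBinom n′ k * poch k * poch (n ∸ k) ≡ poch n′) (ℕ.m+[n∸m]≡n k≤n) (qBinom-poch k (n ∸ k))

    module _ (x^≢1 : ∀ k → x ^ℕ suc k ≢ 1ℚ) where

      1-x^≢0 : ∀ k → 1ℚ - x ^ℕ suc k ≢ 0ℚ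
      1-x^≢0 k 1-x^≡0 = x^≢1 k (begin
        x ^ℕ suc k               ≡⟨ lemma (x ^ℕ suc k) ⟩
        1ℚ - (1ℚ - x ^ℕ suc k)   ≡⟨ cong (λ z → 1ℚ - z) 1-x^≡0 ⟩
        1ℚ                       ∎)
        where
        open ≡-Reasoning
        lemma : ∀ a → a ≡ 1ℚ - (1ℚ - a)
        lemma = solve-∀ ℚ-ring

      poch-≢0 : ∀ k → poch k ≢ 0ℚ
      poch-≢0 zero    = ℚ.1≢0
      poch-≢0 (suc k) = *-≢0 (1-x^≢0 k) (poch-≢0 k)

      qBinom-trinomial : ∀ {s h} e → s ≤ h → qBinom (h ℕ.+ e) s * qBinom (h ∸ s ℕ.+ e) (h ∸ s) ≡ qBinom (h ℕ.+ e) h * qBinom h s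
      qBinom-trinomial {s} {h} e s≤h = *-cancelʳ-≢0 (*-≢0 (*-≢0 (poch-≢0 s) (poch-≢0 (h ∸ s))) (poch-≢0 e)) (begin
        qBinom (h ℕ.+ e) s * qBinom (h ∸ s ℕ.+ e) (h ∸ s) * (poch s * poch (h ∸ s) * poch e)
          ≡⟨ regroup₁ (qBinom (h ℕ.+ e) s) _ (poch s) _ _ ⟩
        qBinom (h ℕ.+ e) s * poch s * (qBinom (h ∸ s ℕ.+ e) (h ∸ s) * poch (h ∸ s) * poch e)
          ≡⟨ cong (qBinom (h ℕ.+ e) s * poch s *_) (qBinom-poch (h ∸ s) e) ⟩
        qBinom (h ℕ.+ e) s * poch s * poch (h ∸ s ℕ.+ e)
          ≡⟨ cong (λ n → qBinom (h ℕ.+ e) s * poch s * poch n) (sym (ℕ.+-∸-comm e s≤h)) ⟩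
        qBinom (h ℕ.+ e) s * poch s * poch (h ℕ.+ e ∸ s)
          ≡⟨ qBinom-poch′ (ℕ.≤-trans s≤h (ℕ.m≤m+n h e)) ⟩
        poch (h ℕ.+ e)
          ≡⟨ sym (qBinom-poch h e) ⟩
        qBinom (h ℕ.+ e) h * poch h * poch e
          ≡⟨ cong (λ p → qBinom (h ℕ.+ e) h * p * poch e) (sym (qBinom-poch′ s≤h)) ⟩
        qBinom (h ℕ.+ e) h * (qBinom h s * poch s * poch (h ∸ s)) * poch e
          ≡⟨ regroup₂ (qBinom (h ℕ.+ e) h) (qBinom h s) _ _ _ ⟩
        qBinom (h ℕ.+ e) h * qBinom h s * (poch s * poch (h ∸ s) * poch e) ∎)
        where
        open ≡-Reasoning
        regroup₁ : ∀ b₁ b₂ p₁ p₂ p₃ → b₁ * b₂ * (p₁ * p₂ * p₃) ≡ b₁ * p₁ * (b₂ * p₂ * p₃)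
        regroup₁ = solve-∀ ℚ-ring
        regroup₂ : ∀ b₁ b₂ p₁ p₂ p₃ → b₁ * (b₂ * p₁ * p₂) * p₃ ≡ b₁ * b₂ * (p₁ * p₂ * p₃)
        regroup₂ = solve-∀ ℚ-ring

      qBinom-*-poch : ∀ h m → qBinom (h ℕ.+ m) h * poch m ≡ prodFromTo (suc h) (h ℕ.+ m) (λ l → 1ℚ - x ^ℕ l)
      qBinom-*-poch h m = *-cancelʳ-≢0 (poch-≢0 h) (begin
        qBinom (h ℕ.+ m) h * poch m * poch h   ≡⟨ *-assoc (qBinom (h ℕ.+ m) h) (poch m) (poch h) ⟩
        qBinom (h ℕ.+ m) h * (poch m * poch h) ≡⟨ cong (qBinom (h ℕ.+ m) h *_) (*-comm (poch m) (poch h)) ⟩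
        qBinom (h ℕ.+ m) h * (poch h * poch m) ≡⟨ sym (*-assoc (qBinom (h ℕ.+ m) h) (poch h) (poch m)) ⟩
        qBinom (h ℕ.+ m) h * poch h * poch m   ≡⟨ qBinom-poch h m ⟩
        poch (h ℕ.+ m)                         ≡⟨ sym (prodFromTo-split (λ l → 1ℚ - x ^ℕ l) (ℕ.m≤m+n h m)) ⟩
        prodFromTo (suc h) (h ℕ.+ m) (λ l → 1ℚ - x ^ℕ l) * poch h ∎)
        where open ≡-Reasoning

      qBinom-poch-exchange : ∀ {s h} w → s ≤ h →
        poch (suc w) * (qBinom (h ℕ.+ w) s * poch (h ∸ s ℕ.+ w) * qBinom (h ∸ s ℕ.+ suc w) (h ∸ s))
        ≡ prodFromTo (suc h) (h ℕ.+ w) (λ l → 1ℚ - x ^ℕ l) * (qBinom h s * poch (h ∸ s ℕ.+ suc w))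
      qBinom-poch-exchange {s} {h} w s≤h = *-cancelʳ-≢0 (*-≢0 (poch-≢0 s) (poch-≢0 k)) (begin
        poch e * (qBinom b s * poch (k ℕ.+ w) * qBinom (k ℕ.+ e) k) * (poch s * poch k)
          ≡⟨ regroup₁ (poch e) (qBinom b s) (poch (k ℕ.+ w)) (qBinom (k ℕ.+ e) k) (poch s) (poch k) ⟩
        qBinom b s * poch s * poch (k ℕ.+ w) * (qBinom (k ℕ.+ e) k * poch k * poch e)
          ≡⟨ cong₂ _*_ b-factor (qBinom-poch k e) ⟩
        poch b * poch (k ℕ.+ e)
          ≡⟨ cong (_* poch (k ℕ.+ e)) (sym (prodFromTo-split (λ l → 1ℚ - x ^ℕ l) (ℕ.m≤m+n h w))) ⟩
        Π * poch h * poch (k ℕ.+ e)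
          ≡⟨ cong (λ p → Π * p * poch (k ℕ.+ e)) (sym (qBinom-poch′ s≤h)) ⟩
        Π * (qBinom h s * poch s * poch k) * poch (k ℕ.+ e)
          ≡⟨ regroup₂ Π (qBinom h s) (poch s) (poch k) (poch (k ℕ.+ e)) ⟩
        Π * (qBinom h s * poch (k ℕ.+ e)) * (poch s * poch k) ∎)
        where
        open ≡-Reasoning
        k e b : ℕ
        k = h ∸ s
        e = suc w
        b = h ℕ.+ w
        Π : ℚ
        Π = prodFromTo (suc h) b (λ l → 1ℚ - x ^ℕ l)
        b-factor : qBinom b s * poch s * poch (k ℕ.+ w) ≡ poch b
        b-factor = trans (cong (λ m → qBinom b s * poch s * poch m) (sym (ℕ.+-∸-comm w s≤h)))
                         (qBinom-poch′ (ℕ.≤-trans s≤h (ℕ.m≤m+n h w)))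
        regroup₁ : ∀ pₑ B p B′ pₛ pₖ → pₑ * (B * p * B′) * (pₛ * pₖ) ≡ B * pₛ * p * (B′ * pₖ * pₑ)
        regroup₁ = solve-∀ ℚ-ring
        regroup₂ : ∀ Π B pₛ pₖ p → Π * (B * pₛ * pₖ) * p ≡ Π * (B * p) * (pₛ * pₖ)
        regroup₂ = solve-∀ ℚ-ring

open RationalAlgebra
open import Data.Nat using (_+_)

⟦_⟧ : ℤ → ℚ
⟦ i ⟧ = ℚ.mkℚ i 0 (Coprime.sym (Coprime.1-coprimeTo ℤ.∣ i ∣))

⟦⟧-* : ∀ i j → ⟦ i ⟧ * ⟦ j ⟧ ≡ ⟦ i ℤ.* j ⟧
⟦⟧-* i j = ℚ.toℚᵘ-injective (ℚ.toℚᵘ-homo-* ⟦ i ⟧ ⟦ j ⟧)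

mq≡⟦-[1+q]⟧ : ∀ q → mq (suc q) ≡ ⟦ -[1+ q ] ⟧
mq≡⟦-[1+q]⟧ q = cong -_ (ℚ.normalize-coprime (Coprime.sym (Coprime.1-coprimeTo (suc q))))

mq^≡⟦-[1+q]^⟧ : ∀ q k → mq (suc q) ^ℕ k ≡ ⟦ -[1+ q ] ℤ.^ k ⟧
mq^≡⟦-[1+q]^⟧ q zero    = refl
mq^≡⟦-[1+q]^⟧ q (suc k) = trans (cong₂ _*_ (mq≡⟦-[1+q]⟧ q) (mq^≡⟦-[1+q]^⟧ q k)) (⟦⟧-* -[1+ q ] _)

∣^∣ : ∀ i n → ℤ.∣ i ℤ.^ n ∣ ≡ ℤ.∣ i ∣ ℕ.^ n
∣^∣ i zero    = refl
∣^∣ i (suc n) = trans (ℤ.abs-* i (i ℤ.^ n)) (cong (ℤ.∣ i ∣ ℕ.*_) (∣^∣ i n))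

mq-≢0 : ∀ {q} → 1 < q → mq q ≢ 0ℚ
mq-≢0 {suc q} _ mq≡0 with cong ℚ.↥_ (trans (sym (mq≡⟦-[1+q]⟧ q)) mq≡0)
... | ()

mq^≢1 : ∀ {q} → 1 < q → ∀ k → mq q ^ℕ suc k ≢ 1ℚ
mq^≢1 {suc q} 1<q k mq^≡1 = ℕ.<⇒≢ (ℕ.^-monoʳ-< (suc q) 1<q {0} {suc k} ℕ.z<s) (sym q^[1+k]≡1)
  where
  q^[1+k]≡1 : suc q ℕ.^ suc k ≡ 1
  q^[1+k]≡1 = begin
    suc q ℕ.^ suc k                  ≡⟨ sym (∣^∣ -[1+ q ] (suc k)) ⟩
    ℤ.∣ -[1+ q ] ℤ.^ suc k ∣         ≡⟨ cong (λ z → ℤ.∣ ℚ.↥ z ∣) (trans (sym (mq^≡⟦-[1+q]^⟧ q (suc k))) mq^≡1) ⟩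
    1                                ∎
    where open ≡-Reasoning

expM-≡ : ∀ q s t r w u → let n = s + t + r + w ; h = s + t + r in
  expM q n h (t + u) (s + t) s
  ≡ (n ℕ.* r + (t ℕ.* (s + r + w) + tri t) + s ℕ.* (2 ℕ.* n)) ⊖ (h ℕ.* h + s ℕ.* (2 ℕ.* (t + u)) + s ℕ.* s)
expM-≡ q s t r w u = begin
  expM q n h c i s
    ≡⟨ cong₂ E (ℕ.m+n∸m≡n i r) half ⟩
  E r K
    ≡⟨ separate (ℤ.+ (n ℕ.* r)) (ℤ.+ K) (ℤ.+ (h ℕ.* h)) (ℤ.+ s) (ℤ.+ (2 ℕ.* n)) (ℤ.+ (2 ℕ.* c)) ⟩
  (ℤ.+ (n ℕ.* r) ℤ.+ ℤ.+ K ℤ.+ ℤ.+ s ℤ.* ℤ.+ (2 ℕ.* n))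
    ℤ.- (ℤ.+ (h ℕ.* h) ℤ.+ ℤ.+ s ℤ.* ℤ.+ (2 ℕ.* c) ℤ.+ ℤ.+ s ℤ.* ℤ.+ s)
    ≡⟨ cong₂ ℤ._-_ (sym pos-A) (sym pos-B) ⟩
  ℤ.+ A ℤ.- ℤ.+ B
    ≡⟨ ℤ.m-n≡m⊖n A B ⟩
  A ⊖ B ∎
  where
  open ≡-Reasoning
  n h i c K A B : ℕ
  n = s + t + r + w
  h = s + t + r
  i = s + t
  c = t + u
  K = t ℕ.* (s + r + w) + tri t
  A = n ℕ.* r + K + s ℕ.* (2 ℕ.* n)
  B = h ℕ.* h + s ℕ.* (2 ℕ.* c) + s ℕ.* s
  E : ℕ → ℕ → ℤ
  E a k = ℤ.+ (n ℕ.* a) ℤ.+ ℤ.+ k ℤ.- ℤ.+ (h ℕ.* h) ℤ.+ ℤ.+ s ℤ.* (ℤ.+ (2 ℕ.* n) ℤ.- ℤ.+ (2 ℕ.* c) ℤ.- ℤ.+ s)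
  half : ((i ∸ s) ℕ.* (2 ℕ.* n ∸ i + s + 1)) ℕ./ 2 ≡ K
  half = trans (cong (ℕ._/ 2) twice) (ℕ.m*n/n≡m K 2)
    where
    2n∸i : 2 ℕ.* n ∸ i ≡ i + (r + w) + (r + w)
    2n∸i = trans (cong (_∸ i) (lemma s t r w)) (ℕ.m+n∸m≡n i (i + (r + w) + (r + w)))
      where
      lemma : ∀ s t r w → 2 ℕ.* (s + t + r + w) ≡ s + t + (s + t + (r + w) + (r + w))
      lemma = ℕ-solve-∀
    twice : (i ∸ s) ℕ.* (2 ℕ.* n ∸ i + s + 1) ≡ K ℕ.* 2
    twice = begin
      (i ∸ s) ℕ.* (2 ℕ.* n ∸ i + s + 1)        ≡⟨ cong₂ (λ a m → a ℕ.* (m + s + 1)) (ℕ.m+n∸m≡n s t) 2n∸i ⟩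
      t ℕ.* (i + (r + w) + (r + w) + s + 1)     ≡⟨ expand s t r w ⟩
      t ℕ.* (s + r + w) ℕ.* 2 + t ℕ.* suc t     ≡⟨ cong (t ℕ.* (s + r + w) ℕ.* 2 +_) (sym (tri-double t)) ⟩
      t ℕ.* (s + r + w) ℕ.* 2 + tri t ℕ.* 2     ≡⟨ sym (ℕ.*-distribʳ-+ 2 (t ℕ.* (s + r + w)) (tri t)) ⟩
      K ℕ.* 2                                    ∎
      where
      expand : ∀ s t r w → t ℕ.* (s + t + (r + w) + (r + w) + s + 1) ≡ t ℕ.* (s + r + w) ℕ.* 2 + t ℕ.* suc t
      expand = ℕ-solve-∀
  separate : ∀ a k hh σ N C →
    a ℤ.+ k ℤ.- hh ℤ.+ σ ℤ.* (N ℤ.- C ℤ.- σ) ≡ (a ℤ.+ k ℤ.+ σ ℤ.* N) ℤ.- (hh ℤ.+ σ ℤ.* C ℤ.+ σ ℤ.* σ)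
  separate = ℤ-solve-∀
  pos-A : ℤ.+ A ≡ ℤ.+ (n ℕ.* r) ℤ.+ ℤ.+ K ℤ.+ ℤ.+ s ℤ.* ℤ.+ (2 ℕ.* n)
  pos-A = trans (ℤ.pos-+ (n ℕ.* r + K) (s ℕ.* (2 ℕ.* n))) (cong₂ ℤ._+_ (ℤ.pos-+ (n ℕ.* r) K) (ℤ.pos-* s (2 ℕ.* n)))
  pos-B : ℤ.+ B ≡ ℤ.+ (h ℕ.* h) ℤ.+ ℤ.+ s ℤ.* ℤ.+ (2 ℕ.* c) ℤ.+ ℤ.+ s ℤ.* ℤ.+ s
  pos-B = trans (ℤ.pos-+ (h ℕ.* h + s ℕ.* (2 ℕ.* c)) (s ℕ.* s))
                (cong₂ ℤ._+_ (trans (ℤ.pos-+ (h ℕ.* h) (s ℕ.* (2 ℕ.* c))) (cong (ℤ._+_ (ℤ.+ (h ℕ.* h))) (ℤ.pos-* s (2 ℕ.* c)))) (ℤ.pos-* s s))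

exponent-balance : ∀ s t r u e a v → v + a ≡ t + r + e →
  let c = t + u ; w = e + c ; n = s + t + r + w ; h = s + t + r in
  n ℕ.* r + (t ℕ.* (s + r + w) + tri t) + s ℕ.* (2 ℕ.* n)
  ≡ s ℕ.* (e + a) + (t ℕ.* e + tri t)
    + (h ℕ.* h + s ℕ.* (2 ℕ.* c) + s ℕ.* s + (r ℕ.* w + (s ℕ.* v + t ℕ.* u)))
exponent-balance s t r u e a v v+a≡t+r+e = begin
  _ ≡⟨ expand s t r u e (tri t) ⟩
  s ℕ.* e + s ℕ.* (t + r + e) + rest ≡⟨ cong (λ z → s ℕ.* e + s ℕ.* z + rest) (sym v+a≡t+r+e) ⟩
  s ℕ.* e + s ℕ.* (v + a) + rest ≡⟨ collect s t r u e a v (tri t) ⟩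
  _ ∎
  where
  open ≡-Reasoning
  rest : ℕ
  rest = t ℕ.* e + tri t + ((s + t + r) ℕ.* (s + t + r) + s ℕ.* (2 ℕ.* (t + u)) + s ℕ.* s + (r ℕ.* (e + (t + u)) + t ℕ.* u))
  expand : ∀ s t r u e T → let c = t + u ; w = e + c ; n = s + t + r + w in
    n ℕ.* r + (t ℕ.* (s + r + w) + T) + s ℕ.* (2 ℕ.* n)
    ≡ s ℕ.* e + s ℕ.* (t + r + e) + (t ℕ.* e + T + ((s + t + r) ℕ.* (s + t + r) + s ℕ.* (2 ℕ.* c) + s ℕ.* s + (r ℕ.* w + t ℕ.* u)))
  expand = ℕ-solve-∀
  collect : ∀ s t r u e a v T → let c = t + u ; w = e + c ; h = s + t + r in
    s ℕ.* e + s ℕ.* (v + a) + (t ℕ.* e + T + (h ℕ.* h + s ℕ.* (2 ℕ.* c) + s ℕ.* s + (r ℕ.* w + t ℕ.* u)))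
    ≡ s ℕ.* (e + a) + (t ℕ.* e + T) + (h ℕ.* h + s ℕ.* (2 ℕ.* c) + s ℕ.* s + (r ℕ.* w + (s ℕ.* v + t ℕ.* u)))
  collect = ℕ-solve-∀

module MinusQ (q : ℕ) (1<q : 1 < q) where

  x y : ℚ
  x = mq q
  y = inv x

  open QBinomial x public

  x*y≡1 : x * y ≡ 1ℚ
  x*y≡1 = inv-inverseʳ (mq-≢0 1<q)

  y*x≡1 : y * x ≡ 1ℚ
  y*x≡1 = inv-inverseˡ (mq-≢0 1<q)

  x^≢1 : ∀ k → x ^ℕ suc k ≢ 1ℚ
  x^≢1 = mq^≢1 1<q

  P-poch : ∀ k → P q k ≡ sign k * y ^ℕ tri k * poch k
  P-poch zero    = refl
  P-poch (suc k) = begin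
    (1ℚ - inv (x ^ℕ suc k)) * P q k
      ≡⟨ cong₂ (λ u v → (1ℚ - u) * v) (inv-^ℕ x (suc k)) (P-poch k) ⟩
    (1ℚ - y ^ℕ suc k) * (sign k * y ^ℕ tri k * poch k)
      ≡⟨ cong (_* (sign k * y ^ℕ tri k * poch k)) (1-a≡-a[1-b] {y ^ℕ suc k} {x ^ℕ suc k} (^ℕ-inverse {y} {x} (suc k) y*x≡1)) ⟩
    - 1ℚ * y ^ℕ suc k * (1ℚ - x ^ℕ suc k) * (sign k * y ^ℕ tri k * poch k)
      ≡⟨ regroup (y ^ℕ suc k) (x ^ℕ suc k) (sign k) (y ^ℕ tri k) (poch k) ⟩
    - 1ℚ * sign k * (y ^ℕ suc k * y ^ℕ tri k) * ((1ℚ - x ^ℕ suc k) * poch k)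
      ≡⟨ cong (λ z → - 1ℚ * sign k * z * ((1ℚ - x ^ℕ suc k) * poch k)) (sym (^ℕ-+ y (suc k) (tri k))) ⟩
    sign (suc k) * y ^ℕ tri (suc k) * poch (suc k) ∎
    where
    open ≡-Reasoning
    regroup : ∀ a b s t p → - 1ℚ * a * (1ℚ - b) * (s * t * p) ≡ - 1ℚ * s * (a * t) * ((1ℚ - b) * p)
    regroup = solve-∀ ℚ-ring

  P-split : ∀ a b → y ^ℕ (a ℕ.* b) * qBinom (a + b) a * P q a * P q b ≡ P q (a + b)
  P-split a b = begin
    y ^ℕ (a ℕ.* b) * qBinom (a + b) a * P q a * P q b
      ≡⟨ cong₂ (λ u v → y ^ℕ (a ℕ.* b) * qBinom (a + b) a * u * v) (P-poch a) (P-poch b) ⟩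
    y ^ℕ (a ℕ.* b) * qBinom (a + b) a * (sign a * y ^ℕ tri a * poch a) * (sign b * y ^ℕ tri b * poch b)
      ≡⟨ regroup (y ^ℕ (a ℕ.* b)) (qBinom (a + b) a) (sign a) (y ^ℕ tri a) (poch a) (sign b) (y ^ℕ tri b) (poch b) ⟩
    sign a * sign b * (y ^ℕ tri a * y ^ℕ tri b * y ^ℕ (a ℕ.* b)) * (qBinom (a + b) a * poch a * poch b)
      ≡⟨ cong₂ (λ u v → u * v * (qBinom (a + b) a * poch a * poch b)) (sym (sign-+ a b)) powers ⟩
    sign (a + b) * y ^ℕ tri (a + b) * (qBinom (a + b) a * poch a * poch b)
      ≡⟨ cong (sign (a + b) * y ^ℕ tri (a + b) *_) (qBinom-poch a b) ⟩
    sign (a + b) * y ^ℕ tri (a + b) * poch (a + b)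
      ≡⟨ sym (P-poch (a + b)) ⟩
    P q (a + b) ∎
    where
    open ≡-Reasoning
    regroup : ∀ e B σ₁ Y₁ p₁ σ₂ Y₂ p₂ → e * B * (σ₁ * Y₁ * p₁) * (σ₂ * Y₂ * p₂) ≡ σ₁ * σ₂ * (Y₁ * Y₂ * e) * (B * p₁ * p₂)
    regroup = solve-∀ ℚ-ring
    powers : y ^ℕ tri a * y ^ℕ tri b * y ^ℕ (a ℕ.* b) ≡ y ^ℕ tri (a + b)
    powers = begin
      y ^ℕ tri a * y ^ℕ tri b * y ^ℕ (a ℕ.* b)  ≡⟨ cong (_* y ^ℕ (a ℕ.* b)) (sym (^ℕ-+ y (tri a) (tri b))) ⟩
      y ^ℕ (tri a + tri b) * y ^ℕ (a ℕ.* b)     ≡⟨ sym (^ℕ-+ y (tri a + tri b) (a ℕ.* b)) ⟩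
      y ^ℕ (tri a + tri b + a ℕ.* b)            ≡⟨ cong (y ^ℕ_) (sym (tri-+ a b)) ⟩
      y ^ℕ tri (a + b)                          ∎

  P-≢0 : ∀ k → P q k ≢ 0ℚ
  P-≢0 k rewrite P-poch k = *-≢0 (*-≢0 sign≢0 y^≢0) (poch-≢0 x^≢1 k)
    where
    sign≢0 : sign k ≢ 0ℚ
    sign≢0 = *≡1⇒≢0 {sign k} (^ℕ-inverse { - 1ℚ} { - 1ℚ} k refl)
    y^≢0 : y ^ℕ tri k ≢ 0ℚ
    y^≢0 = *≡1⇒≢0 {y ^ℕ tri k} (^ℕ-inverse {y} {x} (tri k) y*x≡1)

  P-ratio : ∀ a b → P q (a + b) ÷ (P q a * P q b) ≡ y ^ℕ (a ℕ.* b) * qBinom (a + b) a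
  P-ratio a b = sym (*≡⇒≡÷ (*-≢0 (P-≢0 a) (P-≢0 b)) (trans (sym (*-assoc Y (P q a) (P q b))) (P-split a b)))
    where
    Y : ℚ
    Y = y ^ℕ (a ℕ.* b) * qBinom (a + b) a

  ^ℤ-⊖ : ∀ m n → x ^ℤ (m ⊖ n) ≡ x ^ℕ m * y ^ℕ n
  ^ℤ-⊖ zero    zero    = refl
  ^ℤ-⊖ (suc m) zero    = sym (*-identityʳ _)
  ^ℤ-⊖ zero    (suc n) = trans (inv-^ℕ x (suc n)) (sym (*-identityˡ _))
  ^ℤ-⊖ (suc m) (suc n) = begin
    x ^ℤ (suc m ⊖ suc n)           ≡⟨ cong (x ^ℤ_) (ℤ.[1+m]⊖[1+n]≡m⊖n m n) ⟩
    x ^ℤ (m ⊖ n)                   ≡⟨ ^ℤ-⊖ m n ⟩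
    x ^ℕ m * y ^ℕ n                ≡⟨ sym (*-identityˡ _) ⟩
    1ℚ * (x ^ℕ m * y ^ℕ n)         ≡⟨ cong (_* (x ^ℕ m * y ^ℕ n)) (sym x*y≡1) ⟩
    x * y * (x ^ℕ m * y ^ℕ n)      ≡⟨ interchange x y (x ^ℕ m) (y ^ℕ n) ⟩
    x ^ℕ suc m * y ^ℕ suc n        ∎
    where open ≡-Reasoning

  M-exponent : ∀ s t r u e a v → v + a ≡ t + r + e → let c = t + u ; w = e + c in
    x ^ℤ expM q (s + t + r + w) (s + t + r) c (s + t) s * (y ^ℕ (r ℕ.* w) * (y ^ℕ (s ℕ.* v) * y ^ℕ (t ℕ.* u)))
    ≡ x ^ℕ (s ℕ.* (e + a)) * x ^ℕ (t ℕ.* e + tri t)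
  M-exponent s t r u e a v v+a≡t+r+e = begin
    x ^ℤ expM q n h c (s + t) s * Y
      ≡⟨ cong (λ z → x ^ℤ z * Y) (expM-≡ q s t r w u) ⟩
    x ^ℤ (A ⊖ B) * Y
      ≡⟨ cong (_* Y) (^ℤ-⊖ A B) ⟩
    x ^ℕ A * y ^ℕ B * Y
      ≡⟨ *-assoc (x ^ℕ A) (y ^ℕ B) Y ⟩
    x ^ℕ A * (y ^ℕ B * Y)
      ≡⟨ cong (x ^ℕ A *_) collect-y ⟩
    x ^ℕ A * y ^ℕ (B + Yₑ)
      ≡⟨ cong (λ z → x ^ℕ z * y ^ℕ (B + Yₑ)) (exponent-balance s t r u e a v v+a≡t+r+e) ⟩
    x ^ℕ (E₁ + E₂ + (B + Yₑ)) * y ^ℕ (B + Yₑ)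
      ≡⟨ ^ℕ-+-cancel (E₁ + E₂) (B + Yₑ) x*y≡1 ⟩
    x ^ℕ (E₁ + E₂)
      ≡⟨ ^ℕ-+ x E₁ E₂ ⟩
    x ^ℕ E₁ * x ^ℕ E₂ ∎
    where
    open ≡-Reasoning
    c w n h A B Yₑ E₁ E₂ : ℕ
    c = t + u
    w = e + c
    n = s + t + r + w
    h = s + t + r
    A = n ℕ.* r + (t ℕ.* (s + r + w) + tri t) + s ℕ.* (2 ℕ.* n)
    B = h ℕ.* h + s ℕ.* (2 ℕ.* c) + s ℕ.* s
    Yₑ = r ℕ.* w + (s ℕ.* v + t ℕ.* u)
    Y : ℚ
    Y = y ^ℕ (r ℕ.* w) * (y ^ℕ (s ℕ.* v) * y ^ℕ (t ℕ.* u))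
    E₁ = s ℕ.* (e + a)
    E₂ = t ℕ.* e + tri t
    collect-y : y ^ℕ B * Y ≡ y ^ℕ (B + Yₑ)
    collect-y = sym (trans (^ℕ-+ y B Yₑ) (cong (y ^ℕ B *_)
      (trans (^ℕ-+ y (r ℕ.* w) _) (cong (y ^ℕ (r ℕ.* w) *_) (^ℕ-+ y (s ℕ.* v) (t ℕ.* u))))))

  Ptail : ℕ → ℕ → ℚ
  Ptail s h = prodFromTo (suc s) h (λ l → 1ℚ - x ^ℤ (ℤ.- (ℤ.+ l)))

  M-unfold : ∀ a s t r w u v → let i = s + t ; h = i + r ; c = t + u in
    M q (h + w) h a (s + v) c i s
    ≡ x ^ℤ expM q (h + w) h c i s * sign (i + h) * (P q (r + w) ÷ (P q w * P q h)) * (Ptail s h ÷ (P q r * P q t))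
      * ((P q c * P q (s + v)) ÷ (P q u * P q v)) * 𝒞 q (suc (t + r)) a v u
  M-unfold a s t r w u v =
    unfold n∸i≡r+w (ℕ.m+n∸m≡n h w) (ℕ.m+n∸m≡n i r) (ℕ.m+n∸m≡n s t) c+s∸i≡u (ℕ.m+n∸m≡n s v) 1+h∸s≡1+t+r
    where
    i h c n b : ℕ
    i = s + t
    h = i + r
    c = t + u
    n = h + w
    b = s + v
    unfold : ∀ {k w′ r′ t′ u′ v′ j} →
      n ∸ i ≡ k → n ∸ h ≡ w′ → h ∸ i ≡ r′ → i ∸ s ≡ t′ → c + s ∸ i ≡ u′ → b ∸ s ≡ v′ → suc h ∸ s ≡ j →
      M q n h a b c i s
      ≡ x ^ℤ expM q n h c i s * sign (i + h) * (P q k ÷ (P q w′ * P q h)) * (Ptail s h ÷ (P q r′ * P q t′))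
        * ((P q c * P q b) ÷ (P q u′ * P q v′)) * 𝒞 q j a v′ u′
    unfold refl refl refl refl refl refl refl = refl
    n∸i≡r+w : n ∸ i ≡ r + w
    n∸i≡r+w = trans (cong (_∸ i) (ℕ.+-assoc i r w)) (ℕ.m+n∸m≡n i (r + w))
    c+s∸i≡u : c + s ∸ i ≡ u
    c+s∸i≡u = trans (cong (_∸ i) (lemma s t u)) (ℕ.m+n∸m≡n i u)
      where
      lemma : ∀ s t u → t + u + s ≡ s + t + u
      lemma = ℕ-solve-∀
    1+h∸s≡1+t+r : suc h ∸ s ≡ suc (t + r)
    1+h∸s≡1+t+r = trans (cong (_∸ s) (lemma s t r)) (ℕ.m+n∸m≡n s (suc (t + r)))
      where
      lemma : ∀ s t r → suc (s + t + r) ≡ s + suc (t + r)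
      lemma = ℕ-solve-∀

  P-quotients-cancel : ∀ {s h} k w r t c b u v → s ≤ h →
    (P q k ÷ (P q w * P q h)) * (Ptail s h ÷ (P q r * P q t)) * ((P q c * P q b) ÷ (P q u * P q v))
    ≡ (P q k ÷ (P q r * P q w)) * (P q b ÷ (P q s * P q v)) * (P q c ÷ (P q t * P q u))
  P-quotients-cancel {s} {h} k w r t c b u v s≤h = begin
    (P q k ÷ (P q w * P q h)) * (Ptail s h ÷ (P q r * P q t)) * ((P q c * P q b) ÷ (P q u * P q v))
      ≡⟨ cong (λ z → (P q k ÷ (P q w * P q h)) * (z ÷ (P q r * P q t)) * ((P q c * P q b) ÷ (P q u * P q v))) Ptail≡ ⟩
    (P q k ÷ (P q w * P q h)) * ((P q h ÷ P q s) ÷ (P q r * P q t)) * ((P q c * P q b) ÷ (P q u * P q v))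
      ≡⟨ cong₂ _*_ (cong₂ _*_ (÷-* (P q k) (P q w) (P q h)) (÷-* (P q h ÷ P q s) (P q r) (P q t))) (÷-* (P q c * P q b) (P q u) (P q v)) ⟩
    P q k * (inv (P q w) * inv (P q h)) * (P q h * inv (P q s) * (inv (P q r) * inv (P q t)))
      * (P q c * P q b * (inv (P q u) * inv (P q v)))
      ≡⟨ regroup (P q k) (inv (P q w)) (inv (P q h)) (P q h) (inv (P q s)) (inv (P q r)) (inv (P q t)) (P q c) (P q b) (inv (P q u)) (inv (P q v)) ⟩
    F * (P q h * inv (P q h))
      ≡⟨ trans (cong (F *_) (inv-inverseʳ (P-≢0 h))) (*-identityʳ F) ⟩
    F
      ≡⟨ sym (cong₂ _*_ (cong₂ _*_ (÷-* (P q k) (P q r) (P q w)) (÷-* (P q b) (P q s) (P q v))) (÷-* (P q c) (P q t) (P q u))) ⟩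
    (P q k ÷ (P q r * P q w)) * (P q b ÷ (P q s * P q v)) * (P q c ÷ (P q t * P q u)) ∎
    where
    open ≡-Reasoning
    F : ℚ
    F = P q k * (inv (P q r) * inv (P q w)) * (P q b * (inv (P q s) * inv (P q v))) * (P q c * (inv (P q t) * inv (P q u)))
    ÷-* : ∀ a b c → a ÷ (b * c) ≡ a * (inv b * inv c)
    ÷-* a b c = cong (a *_) (inv-distrib-* b c)
    Ptail≡ : Ptail s h ≡ P q h ÷ P q s
    Ptail≡ = *≡⇒≡÷ (P-≢0 s) (prodFromTo-split (λ l → 1ℚ - x ^ℤ (ℤ.- (ℤ.+ l))) s≤h)
    regroup : ∀ A iW iH H iS iR iT C B iU iV →
      A * (iW * iH) * (H * iS * (iR * iT)) * (C * B * (iU * iV))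
      ≡ A * (iR * iW) * (B * (iS * iV)) * (C * (iT * iU)) * (H * iH)
    regroup = solve-∀ ℚ-ring

  M-term : ∀ {n h a b c s t r u e v} Cp →
    h ≡ s + t + r → c ≡ t + u → n ≡ h + (e + c) → b ≡ s + v → v + a ≡ t + r + e →
    (∀ j u → 𝒞 q (suc j) a v u ≡ sign j * Cp) →
    M q n h a b c (s + t) s
    ≡ x ^ℕ (s ℕ.* (e + a)) * qBinom b s * Cp * (qBinom c t * (sign t * x ^ℕ (t ℕ.* e + tri t) * qBinom (r + e + c) r))
  M-term {a = a} {s = s} {t} {r} {u} {e} {v} Cp refl refl refl refl v+a≡t+r+e 𝒞≡ = begin
    M q n h a b c i s
      ≡⟨ M-unfold a s t r w u v ⟩
    X * σ * Q₁ * Q₂ * Q₃ * 𝒞 q (suc (t + r)) a v u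
      ≡⟨ reassoc X σ Q₁ Q₂ Q₃ (𝒞 q (suc (t + r)) a v u) ⟩
    X * σ * (Q₁ * Q₂ * Q₃) * 𝒞 q (suc (t + r)) a v u
      ≡⟨ cong₂ (λ z C → X * σ * z * C) (trans (P-quotients-cancel (r + w) w r t c b u v s≤h) ratios) (𝒞≡ (t + r) u) ⟩
    X * σ * ((y ^ℕ (r ℕ.* w) * Brw) * (y ^ℕ (s ℕ.* v) * Bb) * (y ^ℕ (t ℕ.* u) * Bc)) * (sign (t + r) * Cp)
      ≡⟨ regroup X σ (y ^ℕ (r ℕ.* w)) Brw (y ^ℕ (s ℕ.* v)) Bb (y ^ℕ (t ℕ.* u)) Bc (sign (t + r)) Cp ⟩
    X * (y ^ℕ (r ℕ.* w) * (y ^ℕ (s ℕ.* v) * y ^ℕ (t ℕ.* u))) * (σ * sign (t + r)) * Bb * Cp * (Bc * Brw)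
      ≡⟨ cong₂ (λ X′ σ′ → X′ * σ′ * Bb * Cp * (Bc * Brw)) (M-exponent s t r u e a v v+a≡t+r+e) signs ⟩
    x ^ℕ (s ℕ.* (e + a)) * x ^ℕ (t ℕ.* e + tri t) * sign t * Bb * Cp * (Bc * Brw)
      ≡⟨ regroup′ (x ^ℕ (s ℕ.* (e + a))) (x ^ℕ (t ℕ.* e + tri t)) (sign t) Bb Cp Bc Brw ⟩
    x ^ℕ (s ℕ.* (e + a)) * Bb * Cp * (Bc * (sign t * x ^ℕ (t ℕ.* e + tri t) * Brw))
      ≡⟨ cong (λ m → x ^ℕ (s ℕ.* (e + a)) * Bb * Cp * (Bc * (sign t * x ^ℕ (t ℕ.* e + tri t) * qBinom m r))) (sym (ℕ.+-assoc r e c)) ⟩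
    x ^ℕ (s ℕ.* (e + a)) * Bb * Cp * (Bc * (sign t * x ^ℕ (t ℕ.* e + tri t) * qBinom (r + e + c) r)) ∎
    where
    open ≡-Reasoning
    i h c w n b : ℕ
    i = s + t
    h = i + r
    c = t + u
    w = e + c
    n = h + w
    b = s + v
    X σ Q₁ Q₂ Q₃ Brw Bb Bc : ℚ
    X = x ^ℤ expM q n h c i s
    σ = sign (i + h)
    Q₁ = P q (r + w) ÷ (P q w * P q h)
    Q₂ = Ptail s h ÷ (P q r * P q t)
    Q₃ = (P q c * P q b) ÷ (P q u * P q v)
    Brw = qBinom (r + w) r
    Bb = qBinom b s
    Bc = qBinom c t
    s≤h : s ≤ h
    s≤h = ℕ.≤-trans (ℕ.m≤m+n s t) (ℕ.m≤m+n i r)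
    ratios : (P q (r + w) ÷ (P q r * P q w)) * (P q b ÷ (P q s * P q v)) * (P q c ÷ (P q t * P q u))
             ≡ (y ^ℕ (r ℕ.* w) * Brw) * (y ^ℕ (s ℕ.* v) * Bb) * (y ^ℕ (t ℕ.* u) * Bc)
    ratios = cong₂ _*_ (cong₂ _*_ (P-ratio r w) (P-ratio s v)) (P-ratio t u)
    signs : σ * sign (t + r) ≡ sign t
    signs = trans (sym (sign-+ (i + h) (t + r))) (trans (cong sign (lemma s t r)) (sign-+-double t h))
      where
      lemma : ∀ s t r → s + t + (s + t + r) + (t + r) ≡ t + (s + t + r + (s + t + r))
      lemma = ℕ-solve-∀
    reassoc : ∀ X σ A B C D → X * σ * A * B * C * D ≡ X * σ * (A * B * C) * D
    reassoc = solve-∀ ℚ-ring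
    regroup : ∀ X σ₁ Y₁ B₁ Y₂ B₂ Y₃ B₃ σ₂ C → X * σ₁ * ((Y₁ * B₁) * (Y₂ * B₂) * (Y₃ * B₃)) * (σ₂ * C)
              ≡ X * (Y₁ * (Y₂ * Y₃)) * (σ₁ * σ₂) * B₂ * C * (B₃ * B₁)
    regroup = solve-∀ ℚ-ring
    regroup′ : ∀ X₁ X₂ σ B₂ C B₃ B₁ → X₁ * X₂ * σ * B₂ * C * (B₃ * B₁) ≡ X₁ * B₂ * C * (B₃ * (σ * X₂ * B₁))
    regroup′ = solve-∀ ℚ-ring

  D-row : ∀ {n h a b c s e v} Cp → s ≤ h → n ≡ h + (e + c) → b ≡ s + v → v + a ≡ h ∸ s + e →
    (∀ j u → 𝒞 q (suc j) a v u ≡ sign j * Cp) →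
    sumFromTo s ((s + c) ⊓ h) (λ i → M q n h a b c i s)
    ≡ x ^ℕ (s ℕ.* (e + a)) * qBinom b s * Cp * qBinom (h ∸ s + e) (h ∸ s)
  D-row {n} {h} {a} {b} {c} {s} {e} {v} Cp s≤h n≡h+[e+c] b≡s+v v+a≡k+e 𝒞≡ = begin
    sumFromTo s ((s + c) ⊓ h) (λ i → M q n h a b c i s)
      ≡⟨ cong (λ z → sumFromTo s z (λ i → M q n h a b c i s)) range ⟩
    sumFromTo s (s + c ⊓ k) (λ i → M q n h a b c i s)
      ≡⟨ sumFromTo-+ s (c ⊓ k) (λ i → M q n h a b c i s) ⟩
    ∑[ t < suc (c ⊓ k) ] M q n h a b c (s + t) s
      ≡⟨ ∑-cong (suc (c ⊓ k)) (λ {t} → term t) ⟩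
    ∑[ t < suc (c ⊓ k) ] (Z * S t)
      ≡⟨ sym (*-∑ (suc (c ⊓ k)) Z S) ⟩
    Z * ∑< (suc (c ⊓ k)) S
      ≡⟨ cong (Z *_) (sym (∑-vanishing-tail (suc k) S (s≤s (ℕ.m⊓n≤n c k)) (λ {t} → vanish t))) ⟩
    Z * ∑< (suc k) S
      ≡⟨ cong (Z *_) (alternating-qVandermonde k e c) ⟩
    Z * qBinom (k + e) k ∎
    where
    open ≡-Reasoning
    k : ℕ
    k = h ∸ s
    Z : ℚ
    Z = x ^ℕ (s ℕ.* (e + a)) * qBinom b s * Cp
    S : ℕ → ℚ
    S t = qBinom c t * alternating-term k e c t
    range : (s + c) ⊓ h ≡ s + c ⊓ k
    range = trans (cong ((s + c) ⊓_) (sym (ℕ.m+[n∸m]≡n s≤h))) (sym (ℕ.+-distribˡ-⊓ s c k))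
    term : ∀ t → t < suc (c ⊓ k) → M q n h a b c (s + t) s ≡ Z * S t
    term t (s≤s t≤c⊓k) = M-term Cp h≡s+t+r (sym (ℕ.m+[n∸m]≡n t≤c)) n≡h+[e+c] b≡s+v
                           (trans v+a≡k+e (cong (_+ e) (sym (ℕ.m+[n∸m]≡n t≤k)))) 𝒞≡
      where
      t≤c : t ≤ c
      t≤c = ℕ.≤-trans t≤c⊓k (ℕ.m⊓n≤m c k)
      t≤k : t ≤ k
      t≤k = ℕ.≤-trans t≤c⊓k (ℕ.m⊓n≤n c k)
      h≡s+t+r : h ≡ s + t + (k ∸ t)
      h≡s+t+r = begin
        h                  ≡⟨ sym (ℕ.m+[n∸m]≡n s≤h) ⟩
        s + k              ≡⟨ cong (s +_) (sym (ℕ.m+[n∸m]≡n t≤k)) ⟩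
        s + (t + (k ∸ t))  ≡⟨ sym (ℕ.+-assoc s t (k ∸ t)) ⟩
        s + t + (k ∸ t)    ∎
    vanish : ∀ t → suc (c ⊓ k) ≤ t → t < suc k → S t ≡ 0ℚ
    vanish t c⊓k<t (s≤s t≤k) with t ℕ.≤? c
    ... | yes t≤c = contradiction (ℕ.⊓-glb t≤c t≤k) (ℕ.<⇒≱ c⊓k<t)
    ... | no t≰c  = trans (cong (_* alternating-term k e c t) (qBinom-> (ℕ.≰⇒> t≰c))) (*-zeroˡ (alternating-term k e c t))

  D-zero-above : ∀ {h b} c → h < b → D q (b + c) h 0 b c ≡ prodFromTo (suc h) b (λ l → 1ℚ - x ^ℕ l) ÷ (1ℚ - x ^ℕ (b ∸ h))
  D-zero-above {h} c h<b with ℕ.m≤n⇒∃[o]m+o≡n (ℕ.<⇒≤ h<b)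
  ... | zero  , refl = contradiction (subst (h <_) (ℕ.+-identityʳ h) h<b) (ℕ.n≮n h)
  ... | suc d , refl = begin
    sumFromTo 0 (h ⊓ b) row
      ≡⟨ cong (λ z → sumFromTo 0 z row) (ℕ.m≤n⇒m⊓n≡m (ℕ.m≤m+n h (suc d))) ⟩
    sumFromTo 0 h row
      ≡⟨ sumFromTo-+ 0 h row ⟩
    ∑< (suc h) row
      ≡⟨ ∑-cong (suc h) (λ {s} → row-≡ s) ⟩
    ∑[ s < suc h ] (qBinom b h * G s)
      ≡⟨ sym (*-∑ (suc h) (qBinom b h) G) ⟩
    qBinom b h * ∑< (suc h) G
      ≡⟨ cong (qBinom b h *_) (poch-expansion d h) ⟩
    qBinom b h * poch d
      ≡⟨ *≡⇒≡÷ (1-x^≢0 x^≢1 d) (begin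
           qBinom b h * poch d * (1ℚ - x ^ℕ suc d)   ≡⟨ *-assoc (qBinom b h) (poch d) (1ℚ - x ^ℕ suc d) ⟩
           qBinom b h * (poch d * (1ℚ - x ^ℕ suc d)) ≡⟨ cong (qBinom b h *_) (*-comm (poch d) (1ℚ - x ^ℕ suc d)) ⟩
           qBinom b h * poch (suc d)                 ≡⟨ qBinom-*-poch x^≢1 h (suc d) ⟩
           prodFromTo (suc h) b (λ l → 1ℚ - x ^ℕ l)  ∎) ⟩
    prodFromTo (suc h) b (λ l → 1ℚ - x ^ℕ l) ÷ (1ℚ - x ^ℕ suc d)
      ≡⟨ cong (λ m → prodFromTo (suc h) b (λ l → 1ℚ - x ^ℕ l) ÷ (1ℚ - x ^ℕ m)) (sym (ℕ.m+n∸m≡n h (suc d))) ⟩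
    prodFromTo (suc h) b (λ l → 1ℚ - x ^ℕ l) ÷ (1ℚ - x ^ℕ (b ∸ h)) ∎
    where
    open ≡-Reasoning
    b n : ℕ
    b = h + suc d
    n = b + c
    row : ℕ → ℚ
    row s = sumFromTo s ((s + c) ⊓ h) (λ i → M q n h 0 b c i s)
    G : ℕ → ℚ
    G s = qBinom h s * (x ^ℕ (s ℕ.* suc d) * poch (d + (h ∸ s)))
    row-≡ : ∀ s → s < suc h → row s ≡ qBinom b h * G s
    row-≡ s (s≤s s≤h) = begin
      row s
        ≡⟨ D-row (poch (k + d)) s≤h (ℕ.+-assoc h (suc d) c) b≡s+v (trans (ℕ.+-identityʳ _) (sym (ℕ.+-suc k d)))
             (λ j u → cong (_* poch (k + d)) (sign-suc-suc j)) ⟩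
      x ^ℕ (s ℕ.* (suc d + 0)) * qBinom b s * poch (k + d) * qBinom (k + suc d) k
        ≡⟨ regroup (x ^ℕ (s ℕ.* (suc d + 0))) (qBinom b s) (poch (k + d)) (qBinom (k + suc d) k) ⟩
      qBinom b s * qBinom (k + suc d) k * (x ^ℕ (s ℕ.* (suc d + 0)) * poch (k + d))
        ≡⟨ cong₂ _*_ (qBinom-trinomial x^≢1 (suc d) s≤h)
                     (cong₂ (λ e m → x ^ℕ (s ℕ.* e) * poch m) (ℕ.+-identityʳ (suc d)) (ℕ.+-comm k d)) ⟩
      qBinom b h * qBinom h s * (x ^ℕ (s ℕ.* suc d) * poch (d + k))
        ≡⟨ *-assoc (qBinom b h) (qBinom h s) _ ⟩
      qBinom b h * G s ∎
      where
      k : ℕ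
      k = h ∸ s
      b≡s+v : b ≡ s + suc (k + d)
      b≡s+v = trans (cong (_+ suc d) (sym (ℕ.m+[n∸m]≡n s≤h))) (lemma s k d)
        where
        lemma : ∀ s k d → s + k + suc d ≡ s + suc (k + d)
        lemma = ℕ-solve-∀
      regroup : ∀ X B p B′ → X * B * p * B′ ≡ B * B′ * (X * p)
      regroup = solve-∀ ℚ-ring

  D-one-below : ∀ b c → D q (suc (b + c)) (suc b) 1 b c ≡ 1ℚ
  D-one-below b c = begin
    sumFromTo 0 (suc b ⊓ b) row
      ≡⟨ cong (λ z → sumFromTo 0 z row) (ℕ.m≥n⇒m⊓n≡n (ℕ.n≤1+n b)) ⟩
    sumFromTo 0 b row
      ≡⟨ sumFromTo-+ 0 b row ⟩
    ∑< (suc b) row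
      ≡⟨ ∑-cong (suc b) (λ {s} → row-≡ s) ⟩
    ∑[ s < suc b ] (qBinom b s * (x ^ℕ (s ℕ.* 1) * poch (b ∸ s)))
      ≡⟨ poch-expansion 0 b ⟩
    1ℚ ∎
    where
    open ≡-Reasoning
    row : ℕ → ℚ
    row s = sumFromTo s ((s + c) ⊓ suc b) (λ i → M q (suc (b + c)) (suc b) 1 b c i s)
    row-≡ : ∀ s → s < suc b → row s ≡ qBinom b s * (x ^ℕ (s ℕ.* 1) * poch (b ∸ s))
    row-≡ s (s≤s s≤b) = begin
      row s
        ≡⟨ D-row (poch (b ∸ s)) (ℕ.m≤n⇒m≤1+n s≤b) refl (sym (ℕ.m+[n∸m]≡n s≤b)) v+1≡k+0
             (λ j u → cong (_* poch (b ∸ s)) (sign-suc-suc j)) ⟩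
      x ^ℕ (s ℕ.* 1) * qBinom b s * poch (b ∸ s) * qBinom (k + 0) k
        ≡⟨ cong (x ^ℕ (s ℕ.* 1) * qBinom b s * poch (b ∸ s) *_) (trans (cong (λ m → qBinom m k) (ℕ.+-identityʳ k)) (qBinom-diag k)) ⟩
      x ^ℕ (s ℕ.* 1) * qBinom b s * poch (b ∸ s) * 1ℚ
        ≡⟨ regroup (x ^ℕ (s ℕ.* 1)) (qBinom b s) (poch (b ∸ s)) ⟩
      qBinom b s * (x ^ℕ (s ℕ.* 1) * poch (b ∸ s)) ∎
      where
      k : ℕ
      k = suc b ∸ s
      v+1≡k+0 : b ∸ s + 1 ≡ k + 0
      v+1≡k+0 = trans (ℕ.+-comm (b ∸ s) 1) (trans (sym (ℕ.+-∸-assoc 1 s≤b)) (sym (ℕ.+-identityʳ k)))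
      regroup : ∀ X B p → X * B * p * 1ℚ ≡ B * (X * p)
      regroup = solve-∀ ℚ-ring

  D-one-above : ∀ {h b} c → h ≤ b → D q (suc (b + c)) h 1 b c ≡ prodFromTo (suc h) b (λ l → 1ℚ - x ^ℕ l)
  D-one-above {h} c h≤b with ℕ.m≤n⇒∃[o]m+o≡n h≤b
  ... | w , refl = *-cancelʳ-≢0 (poch-≢0 x^≢1 e) (begin
    sumFromTo 0 (h ⊓ b) row * poch e
      ≡⟨ cong (λ z → sumFromTo 0 z row * poch e) (ℕ.m≤n⇒m⊓n≡m (ℕ.m≤m+n h w)) ⟩
    sumFromTo 0 h row * poch e
      ≡⟨ cong (_* poch e) (sumFromTo-+ 0 h row) ⟩
    ∑< (suc h) row * poch e
      ≡⟨ *-comm (∑< (suc h) row) (poch e) ⟩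
    poch e * ∑< (suc h) row
      ≡⟨ *-∑ (suc h) (poch e) row ⟩
    ∑[ s < suc h ] (poch e * row s)
      ≡⟨ ∑-cong (suc h) (λ {s} → row-≡ s) ⟩
    ∑[ s < suc h ] (Π * G s)
      ≡⟨ sym (*-∑ (suc h) Π G) ⟩
    Π * ∑< (suc h) G
      ≡⟨ cong (Π *_) (poch-expansion e h) ⟩
    Π * poch e ∎)
    where
    open ≡-Reasoning
    b e : ℕ
    b = h + w
    e = suc w
    Π : ℚ
    Π = prodFromTo (suc h) b (λ l → 1ℚ - x ^ℕ l)
    row : ℕ → ℚ
    row s = sumFromTo s ((s + c) ⊓ h) (λ i → M q (suc (b + c)) h 1 b c i s)
    G : ℕ → ℚ
    G s = qBinom h s * (x ^ℕ (s ℕ.* suc e) * poch (e + (h ∸ s)))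
    row-≡ : ∀ s → s < suc h → poch e * row s ≡ Π * G s
    row-≡ s (s≤s s≤h) = begin
      poch e * row s
        ≡⟨ cong (poch e *_) (D-row (poch (k + w)) s≤h n≡h+[e+c] b≡s+[k+w] v+1≡k+e
                                   (λ j u → cong (_* poch (k + w)) (sign-suc-suc j))) ⟩
      poch e * (X * qBinom b s * poch (k + w) * qBinom (k + e) k)
        ≡⟨ pull-out (poch e) X (qBinom b s) (poch (k + w)) (qBinom (k + e) k) ⟩
      X * (poch e * (qBinom b s * poch (k + w) * qBinom (k + e) k))
        ≡⟨ cong (X *_) (qBinom-poch-exchange x^≢1 w s≤h) ⟩
      X * (Π * (qBinom h s * poch (k + e)))
        ≡⟨ push-in X Π (qBinom h s) (poch (k + e)) ⟩
      Π * (qBinom h s * (X * poch (k + e)))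
        ≡⟨ cong₂ (λ m n → Π * (qBinom h s * (x ^ℕ (s ℕ.* m) * poch n))) (ℕ.+-comm e 1) (ℕ.+-comm k e) ⟩
      Π * G s ∎
      where
      k : ℕ
      k = h ∸ s
      X : ℚ
      X = x ^ℕ (s ℕ.* (e + 1))
      n≡h+[e+c] : suc (b + c) ≡ h + (e + c)
      n≡h+[e+c] = lemma h w c
        where
        lemma : ∀ h w c → suc (h + w + c) ≡ h + (suc w + c)
        lemma = ℕ-solve-∀
      b≡s+[k+w] : b ≡ s + (k + w)
      b≡s+[k+w] = trans (cong (_+ w) (sym (ℕ.m+[n∸m]≡n s≤h))) (ℕ.+-assoc s k w)
      v+1≡k+e : k + w + 1 ≡ k + e
      v+1≡k+e = trans (ℕ.+-assoc k w 1) (cong (k +_) (ℕ.+-comm w 1))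
      pull-out : ∀ pₑ X B p B′ → pₑ * (X * B * p * B′) ≡ X * (pₑ * (B * p * B′))
      pull-out = solve-∀ ℚ-ring
      push-in : ∀ X Π B p → X * (Π * (B * p)) ≡ Π * (B * (X * p))
      push-in = solve-∀ ℚ-ring

oddPrimePower⇒1<q : ∀ {q} → IsOddPrimePower q → 1 < q
oddPrimePower⇒1<q (p , k , p-prime , _ , 0<k , refl) =
  ℕ.^-monoʳ-< p (ℕ.nonTrivial⇒n>1 p {{prime⇒nonTrivial p-prime}}) 0<k

theorem9p8 : (q : ℕ) → IsOddPrimePower q → (n h : ℕ) → h ≤ n →
  ((b c : ℕ) → suc h ≤ b → b ≤ n → b + c ≡ n →
    D q n h 0 b c
      ≡ prodFromTo (suc h) b (λ l → 1ℚ - mq q ^ℕ l) ÷ (1ℚ - mq q ^ℕ (b ∸ h)))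
  ×
  ((b c : ℕ) → h ≤ suc b → b ≤ n → suc (b + c) ≡ n →
    ((suc b ≡ h ⊎ b ≡ h) → D q n h 1 b c ≡ 1ℚ)
    × (suc h ≤ b → D q n h 1 b c ≡ prodFromTo (suc h) b (λ l → 1ℚ - mq q ^ℕ l)))
theorem9p8 q q-oddPrimePower n h _ = zero-above , one
  where
  open MinusQ q (oddPrimePower⇒1<q q-oddPrimePower)
  zero-above : (b c : ℕ) → suc h ≤ b → b ≤ n → b + c ≡ n →
    D q n h 0 b c ≡ prodFromTo (suc h) b (λ l → 1ℚ - mq q ^ℕ l) ÷ (1ℚ - mq q ^ℕ (b ∸ h))
  zero-above b c h<b _ refl = D-zero-above c h<b
  one : (b c : ℕ) → h ≤ suc b → b ≤ n → suc (b + c) ≡ n →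
    ((suc b ≡ h ⊎ b ≡ h) → D q n h 1 b c ≡ 1ℚ) × (suc h ≤ b → D q n h 1 b c ≡ prodFromTo (suc h) b (λ l → 1ℚ - mq q ^ℕ l))
  one b c _ _ refl = one-at-h-1-or-h , λ h<b → D-one-above c (ℕ.<⇒≤ h<b)
    where
    one-at-h-1-or-h : (suc b ≡ h ⊎ b ≡ h) → D q (suc (b + c)) h 1 b c ≡ 1ℚ
    one-at-h-1-or-h (inj₁ refl) = D-one-below b c
    one-at-h-1-or-h (inj₂ refl) = trans (D-one-above {b} c ℕ.≤-refl) (prodFromTo-empty b (λ l → 1ℚ - mq q ^ℕ l))
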